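{- Let $\ell\ge 2$, let $p\in S_\ell$ be a permutation pattern and let $k=\ell-2$. The following statements are equivalent: (1) $p$ is a Baxter permutation; (2) for each $n\ge k$ and each $k$-element set $H\subseteq[n]$, $s_n^H(p)=1$; (3) for $n=k+3$ and each $k$-element set $H\subseteq[n]$, $s_n^H(p)=1$; (4) there exists $n\ge k+3$ such that for each $k$-element set $H\subseteq[n]$, $s_n^H(p)=1$.
   Context: A permutation $p\in S_\ell$ is a Baxter permutation if there are no indices $a<b<c<d$ in $[\ell]$ with $c=b+1$ such that $p_a,p_b,p_c,p_d$ is order-isomorphic to $2413$ or to $3142$. For $H\subseteq[n]$, $S_n^H$ is the set of sequences $\pi_1\cdots\pi_n$ with $\pi_i$ equal to a hole symbol $\diamond$ iff $i\in H$, the other entries being $1,\dots,n-|H|$ each exactly once. A permutation $\sigma$ of $[n]$ is an extension of $\pi$ if the standardization (order-preserving relabeling by $1,2,\dots$) of $\sigma$ restricted to the non-hole positions equals $\pi$ restricted to them; $\pi$ avoids $p$ if every extension of $\pi$ avoids $p$ classically. $s_n^H(p)$ is the number of $p$-avoiding elements of $S_n^H$. -}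

module Defs where

open import Data.Nat using (ℕ; suc; _≤_; _<_; _∸_)
open import Data.Fin using (Fin; toℕ)
import Data.Fin as F
open import Data.Fin.Subset using (Subset; _∈_; _∉_; ∣_∣)
open import Data.Fin.Permutation using (Permutation′; _⟨$⟩ʳ_)
open import Data.Maybe using (Maybe; just; nothing)
open import Data.Vec using (Vec; lookup)
open import Data.List using (List; length)
open import Data.List.Relation.Unary.Unique.Propositional using (Unique)
import Data.List.Membership.Propositional as LM
open import Data.Product using (Σ; ∃; ∃-syntax; _×_; _,_)
open import Data.Empty using (⊥)
open import Function.Bundles using (_⇔_)
open import Relation.Binary.PropositionalEquality using (_≡_)
open import Relation.Nullary using (¬_)

-- value of a permutation (values in Fin, 0-based; only relative order matters)
val : ∀ {n} → Permutation′ n → Fin n → ℕ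
val σ i = toℕ (σ ⟨$⟩ʳ i)

Contains : ∀ {n ℓ} → Permutation′ n → Permutation′ ℓ → Set
Contains {n} {ℓ} σ p =
  Σ (Fin ℓ → Fin n) λ f →
    (∀ i j → i F.< j → f i F.< f j) ×
    (∀ i j → (val p i < val p j) ⇔ (val σ (f i) < val σ (f j)))

AvoidsClassically : ∀ {n ℓ} → Permutation′ n → Permutation′ ℓ → Set
AvoidsClassically σ p = ¬ Contains σ p

-- Baxter permutation: no a<b<c<d with c = b+1 such that p_a p_b p_c p_d
-- is order-isomorphic to 2413 (p_c < p_a < p_d < p_b) or to
-- 3142 (p_b < p_d < p_a < p_c)
IsBaxter : ∀ {ℓ} → Permutation′ ℓ → Set
IsBaxter {ℓ} p =
  ∀ (a b c d : Fin ℓ) → a F.< b → b F.< c → c F.< d → toℕ c ≡ suc (toℕ b) →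
    ¬ (val p c < val p a × val p a < val p d × val p d < val p b) ×
    ¬ (val p b < val p d × val p d < val p a × val p a < val p c)

-- Partial permutations: π ∈ S_n^H is a sequence of length n whose entries
-- are `nothing` (the hole symbol ◇) exactly at the positions in H, and whose
-- other entries are `just v`, where the values v ∈ {1,…,n-|H|} each occur
-- exactly once.
InS : (n : ℕ) → Subset n → Vec (Maybe ℕ) n → Set
InS n H π =
  (∀ i → (lookup π i ≡ nothing) ⇔ (i ∈ H)) ×
  (∀ i v → lookup π i ≡ just v → (1 ≤ v × v ≤ n ∸ ∣ H ∣)) ×
  (∀ v → 1 ≤ v → v ≤ n ∸ ∣ H ∣ →
     Σ (Fin n) λ i → lookup π i ≡ just v × (∀ j → lookup π j ≡ just v → j ≡ i))

-- σ ∈ S_n is an extension of π: the standardization of σ restricted to the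
-- non-hole positions equals π restricted to them, i.e. on non-hole positions
-- σ and π have the same relative order (π's non-hole values are already the
-- standard set {1,…,n-|H|}).
Extension : ∀ {n} → Permutation′ n → Vec (Maybe ℕ) n → Set
Extension {n} σ π =
  ∀ (i j : Fin n) (x y : ℕ) → lookup π i ≡ just x → lookup π j ≡ just y →
    (x < y) ⇔ (val σ i < val σ j)

Avoids : ∀ {n ℓ} → Vec (Maybe ℕ) n → Permutation′ ℓ → Set
Avoids {n} π p = ∀ (σ : Permutation′ n) → Extension σ π → AvoidsClassically σ p

-- s_n^H(p) = c : the set of p-avoiding elements of S_n^H has exactly c
-- elements, i.e. it is listed by a duplicate-free list of length c.
sCount : ∀ {ℓ} (n : ℕ) → Subset n → Permutation′ ℓ → ℕ → Set
sCount n H p c =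
  Σ (List (Vec (Maybe ℕ) n)) λ xs →
    Unique xs ×
    (∀ π → (π LM.∈ xs) ⇔ (InS n H π × Avoids π p)) ×
    length xs ≡ c

-- Let k = ℓ - 2 = |H| and let h(x) count the holes before position x. Counting the ℓ = k + 2 entries
-- of any occurrence of p in an extension of π ∈ S_n^H against the holes locates two non-holes x < y
-- of the occurrence at indices h(x) and h(y) + 1 of p; conversely, for such x, y the holes can be
-- filled to an occurrence made of all holes plus x and y. Hence π avoids p iff for all non-holes
-- x < y, π x < π y ⇔ p(h(y) + 1) < p(h(x)). This prescribes a relation on the non-hole positions,
-- which an avoider must realise as the order of its values: so there is at most one avoider, and
-- there is one exactly when the relation is transitive. A failure of transitivity on three
-- positions is a Baxter pattern p_a p_b p_(b+1) p_d, and for n ≥ k + 3 three suitably placed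
-- non-holes exhibit any such pattern, leaving no avoider at all.

module Submission where

open import Data.Bool using (Bool; true; false; _∨_; _∧_; not)
open import Data.Empty using (⊥; ⊥-elim)
open import Data.Fin using (Fin; toℕ; fromℕ<; zero; suc; punchOut)
import Data.Fin as F
import Data.Fin.Properties as FP
open import Data.Fin.Permutation using (Permutation′; _⟨$⟩ˡ_; inverseˡ)
open import Data.Fin.Subset using (Subset; ∣_∣; _∈_)
open import Data.List using ([]; _∷_)
open import Data.List.Membership.Propositional using () renaming (_∈_ to _∈ₗ_)
open import Data.List.Relation.Unary.Any using (here)
import Data.List.Relation.Unary.All as All
import Data.List.Relation.Unary.AllPairs as AllPairs
open import Data.Maybe using (Maybe; just; nothing)
import Data.Maybe.Properties as MP
open import Data.Nat using (ℕ; zero; suc; _+_; _*_; _∸_; _≤_; _<_; z≤n; s≤s; s≤s⁻¹; s<s⁻¹; _<?_; _≟_; _≤?_)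
open import Data.Nat.Properties
open import Data.Product using (Σ; ∃; _×_; _,_; proj₁; proj₂)
open import Data.Product.Relation.Binary.Lex.Strict using (×-Lex; ×-strictTotalOrder)
open import Data.Sum using (_⊎_; inj₁; inj₂)
open import Data.Unit using (⊤; tt)
open import Data.Vec using (Vec; []; _∷_; lookup; tabulate)
import Data.Vec.Properties as VP
open import Function.Base using (case_of_; id)
open import Function.Bundles using (_⇔_; mk⇔; Equivalence; mk↔ₛ′)
open import Function.Construct.Symmetry using (⇔-sym)
open import Function.Properties.Equivalence using () renaming (trans to ⇔-trans)
open import Level using (0ℓ)
open import Relation.Binary.Bundles using (StrictTotalOrder)
open import Relation.Binary.Definitions using (tri<; tri≈; tri>)
open import Relation.Binary.PropositionalEquality
open import Relation.Nullary using (¬_; Dec; yes; no; does)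
open import Relation.Nullary.Decidable using (_⊎-dec_; _×-dec_; ¬?)

open import Defs
open import Algebra.Properties.CommutativeMonoid.Sum +-0-commutativeMonoid
  using (sum; sum-cong-≗; ∑-distrib-+)
open Equivalence using (to; from)

indicator : ∀ {a} {P : Set a} → Dec P → ℕ
indicator (yes _) = 1
indicator (no _)  = 0

indicator-yes : ∀ {a} {P : Set a} (d : Dec P) → P → indicator d ≡ 1
indicator-yes (yes _) _  = refl
indicator-yes (no ¬p) p = ⊥-elim (¬p p)

indicator-no : ∀ {a} {P : Set a} (d : Dec P) → ¬ P → indicator d ≡ 0
indicator-no (yes p) ¬p = ⊥-elim (¬p p)
indicator-no (no _)  _  = refl

indicator-cong : ∀ {a b} {P : Set a} {Q : Set b} (d : Dec P) (e : Dec Q) →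
                 (P → Q) → (Q → P) → indicator d ≡ indicator e
indicator-cong (yes p) (yes q) f g = refl
indicator-cong (yes p) (no ¬q) f g = ⊥-elim (¬q (f p))
indicator-cong (no ¬p) (yes q) f g = ⊥-elim (¬p (g q))
indicator-cong (no ¬p) (no ¬q) f g = refl

indicator≤1 : ∀ {a} {P : Set a} (d : Dec P) → indicator d ≤ 1
indicator≤1 (yes _) = s≤s z≤n
indicator≤1 (no _)  = z≤n

indicator-mono : ∀ {a b} {P : Set a} {Q : Set b} (d : Dec P) (e : Dec Q) →
                 (P → Q) → indicator d ≤ indicator e
indicator-mono (yes p) (yes q) f = ≤-refl
indicator-mono (yes p) (no ¬q) f = ⊥-elim (¬q (f p))
indicator-mono (no ¬p) e       f = z≤n

indicator-<-suc : ∀ a z → indicator (a <? suc z) ≡ indicator (a <? z) + indicator (a ≟ z)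
indicator-<-suc a z with <-cmp a z
... | tri< a<z a≢z _ = trans (indicator-yes (a <? suc z) (m≤n⇒m≤1+n a<z))
                         (sym (cong₂ _+_ (indicator-yes (a <? z) a<z) (indicator-no (a ≟ z) a≢z)))
... | tri≈ a≮z refl _ = trans (indicator-yes (a <? suc z) ≤-refl)
                         (sym (cong₂ _+_ (indicator-no (a <? z) a≮z) (indicator-yes (a ≟ z) refl)))
... | tri> _ a≢z z<a = trans (indicator-no (a <? suc z) (λ a<1+z → <-irrefl refl (<-≤-trans z<a (s≤s⁻¹ a<1+z))))
                         (sym (cong₂ _+_ (indicator-no (a <? z) (<-asym z<a)) (indicator-no (a ≟ z) a≢z)))

sum-mono-≤ : ∀ {n} (f g : Fin n → ℕ) → (∀ i → f i ≤ g i) → sum f ≤ sum g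
sum-mono-≤ {zero}  f g f≤g = z≤n
sum-mono-≤ {suc n} f g f≤g = +-mono-≤ (f≤g zero) (sum-mono-≤ _ _ (λ i → f≤g (suc i)))

sum-mono-< : ∀ {n} (f g : Fin n → ℕ) → (∀ i → f i ≤ g i) → (j : Fin n) → f j < g j → sum f < sum g
sum-mono-< {suc n} f g f≤g zero    fj<gj = +-mono-<-≤ fj<gj (sum-mono-≤ _ _ (λ i → f≤g (suc i)))
sum-mono-< {suc n} f g f≤g (suc j) fj<gj = +-mono-≤-< (f≤g zero) (sum-mono-< _ _ (λ i → f≤g (suc i)) j fj<gj)

sum-zero : ∀ {n} (f : Fin n → ℕ) → (∀ i → f i ≡ 0) → sum f ≡ 0
sum-zero {zero}  f f≡0 = refl
sum-zero {suc n} f f≡0 rewrite f≡0 zero = sum-zero _ (λ i → f≡0 (suc i))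

sum-single : ∀ {n} (f : Fin n → ℕ) (j : Fin n) → (∀ i → i ≢ j → f i ≡ 0) → sum f ≡ f j
sum-single {suc n} f zero    f≡0 = trans (cong (f zero +_) (sum-zero _ (λ i → f≡0 (suc i) (λ ())))) (+-identityʳ _)
sum-single {suc n} f (suc j) f≡0 rewrite f≡0 zero (λ ()) =
  sum-single (λ i → f (suc i)) j (λ i i≢j → f≡0 (suc i) (λ eq → i≢j (FP.suc-injective eq)))

sum-pick : ∀ {n} (j : Fin n) (g : Fin n → ℕ) → sum (λ i → indicator (i FP.≟ j) * g i) ≡ g j
sum-pick j g = trans (sum-single _ j (λ i i≢j → cong (_* g i) (indicator-no (i FP.≟ j) i≢j)))
                     (trans (cong (_* g j) (indicator-yes (j FP.≟ j) refl)) (+-identityʳ (g j)))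

sum-ones : ∀ {n} (f : Fin n → ℕ) → (∀ i → f i ≡ 1) → sum f ≡ n
sum-ones {zero}  f f≡1 = refl
sum-ones {suc n} f f≡1 = cong₂ _+_ (f≡1 zero) (sum-ones _ (λ i → f≡1 (suc i)))

sum-<-length : ∀ {n} (f : Fin n → ℕ) → (∀ i → f i ≤ 1) → (j : Fin n) → f j ≡ 0 → sum f < n
sum-<-length f f≤1 j fj≡0 =
  subst (sum f <_) (sum-ones {_} (λ _ → 1) (λ _ → refl))
        (sum-mono-< f _ f≤1 j (subst (_< 1) (sym fj≡0) (s≤s z≤n)))

sum-indicator-< : ∀ {n} m → m ≤ n → sum {n} (λ i → indicator (toℕ i <? m)) ≡ m
sum-indicator-< {zero}  zero    _         = refl
sum-indicator-< {suc n} zero    _         = sum-zero {suc n} _ (λ i → indicator-no (toℕ i <? 0) (λ ()))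
sum-indicator-< {suc n} (suc m) (s≤s m≤n) = cong suc (trans
  (sum-cong-≗ {n} (λ i → indicator-cong (suc (toℕ i) <? suc m) (toℕ i <? m) s≤s⁻¹ s≤s))
  (sum-indicator-< {n} m m≤n))

injective⇒surjective : ∀ {n} (f : Fin n → Fin n) → (∀ {i j} → f i ≡ f j → i ≡ j) → ∀ v → ∃ λ i → f i ≡ v
injective⇒surjective {zero}  f f-inj ()
injective⇒surjective {suc n} f f-inj v with FP.any? (λ i → f i FP.≟ v)
... | yes hit = hit
... | no miss =
  let i , j , i<j , eq = FP.pigeonhole (n<1+n n) (λ i → punchOut (v≢f i))
  in ⊥-elim (FP.<⇒≢ i<j (f-inj (FP.punchOut-injective (v≢f i) (v≢f j) eq)))
  where
  v≢f : ∀ i → v ≢ f i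
  v≢f i e = miss (i , sym e)

record StrictLinearOrder (n : ℕ) : Set₁ where
  field
    _≺_         : Fin n → Fin n → Set
    _≺?_        : ∀ i j → Dec (i ≺ j)
    ≺-irrefl    : ∀ i → ¬ (i ≺ i)
    ≺-trans     : ∀ {i j k} → i ≺ j → j ≺ k → i ≺ k
    ≺-connected : ∀ i j → i ≢ j → (i ≺ j) ⊎ (j ≺ i)

module Ranking {n} (O : StrictLinearOrder n) where
  open StrictLinearOrder O

  rank : Fin n → ℕ
  rank i = sum (λ j → indicator (j ≺? i))

  rank-mono : ∀ {i j} → i ≺ j → rank i < rank j
  rank-mono {i} {j} i≺j =
    sum-mono-< _ _ (λ k → indicator-mono (k ≺? i) (k ≺? j) (λ k≺i → ≺-trans k≺i i≺j)) i
      (subst₂ _<_ (sym (indicator-no (i ≺? i) (≺-irrefl i))) (sym (indicator-yes (i ≺? j) i≺j)) (s≤s z≤n))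

  rank<n : ∀ i → rank i < n
  rank<n i = sum-<-length _ (λ j → indicator≤1 (j ≺? i)) i (indicator-no (i ≺? i) (≺-irrefl i))

  rank-cancel-< : ∀ {i j} → rank i < rank j → i ≺ j
  rank-cancel-< {i} {j} ri<rj with i FP.≟ j
  ... | yes refl = ⊥-elim (<-irrefl refl ri<rj)
  ... | no i≢j with ≺-connected i j i≢j
  ... | inj₁ i≺j = i≺j
  ... | inj₂ j≺i = ⊥-elim (<-asym ri<rj (rank-mono j≺i))

  rank-injective : ∀ {i j} → rank i ≡ rank j → i ≡ j
  rank-injective {i} {j} ri≡rj with i FP.≟ j
  ... | yes i≡j = i≡j
  ... | no i≢j with ≺-connected i j i≢j
  ... | inj₁ i≺j = ⊥-elim (<-irrefl ri≡rj (rank-mono i≺j))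
  ... | inj₂ j≺i = ⊥-elim (<-irrefl (sym ri≡rj) (rank-mono j≺i))

  rankFin : Fin n → Fin n
  rankFin i = fromℕ< (rank<n i)

  rankFin-injective : ∀ {i j} → rankFin i ≡ rankFin j → i ≡ j
  rankFin-injective {i} {j} e = rank-injective
    (trans (sym (FP.toℕ-fromℕ< (rank<n i))) (trans (cong toℕ e) (FP.toℕ-fromℕ< (rank<n j))))

  unrank : Fin n → Fin n
  unrank v = proj₁ (injective⇒surjective rankFin rankFin-injective v)

  rank-unrank : ∀ v → rank (unrank v) ≡ toℕ v
  rank-unrank v = trans (sym (FP.toℕ-fromℕ< (rank<n (unrank v))))
    (cong toℕ (proj₂ (injective⇒surjective rankFin rankFin-injective v)))

  ranking : Permutation′ n
  ranking = mk↔ₛ′ rankFin unrank (λ v → proj₂ (injective⇒surjective rankFin rankFin-injective v))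
                  (λ i → rankFin-injective (proj₂ (injective⇒surjective rankFin rankFin-injective (rankFin i))))

  val-ranking : ∀ i → val ranking i ≡ rank i
  val-ranking i = FP.toℕ-fromℕ< (rank<n i)

  ≺⇒ranking< : ∀ {i j} → i ≺ j → val ranking i < val ranking j
  ≺⇒ranking< i≺j = subst₂ _<_ (sym (val-ranking _)) (sym (val-ranking _)) (rank-mono i≺j)

  ranking<⇒≺ : ∀ {i j} → val ranking i < val ranking j → i ≺ j
  ranking<⇒≺ lt = rank-cancel-< (subst₂ _<_ (val-ranking _) (val-ranking _) lt)

bit : Bool → ℕ
bit true  = 1
bit false = 0

∣∣≡sum-bit : ∀ {n} (V : Subset n) → ∣ V ∣ ≡ sum (λ i → bit (lookup V i))
∣∣≡sum-bit []          = refl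
∣∣≡sum-bit (true ∷ V)  = cong suc (∣∣≡sum-bit V)
∣∣≡sum-bit (false ∷ V) = ∣∣≡sum-bit V

countBelow : ∀ {n} → Subset n → ℕ → ℕ
countBelow V z = sum (λ i → bit (lookup V i) * indicator (toℕ i <? z))

countBelow-zero : ∀ {n} (V : Subset n) → countBelow V 0 ≡ 0
countBelow-zero V = sum-zero _ (λ i →
  trans (cong (bit (lookup V i) *_) (indicator-no (toℕ i <? 0) (λ ()))) (*-zeroʳ (bit (lookup V i))))

countBelow-∷ : ∀ {n} b (V : Subset n) z → countBelow (b ∷ V) (suc z) ≡ bit b + countBelow V z
countBelow-∷ b V z = cong₂ _+_ (*-identityʳ (bit b)) (sum-cong-≗ (λ i →
  cong (bit (lookup V i) *_) (indicator-cong (suc (toℕ i) <? suc z) (toℕ i <? z) s≤s⁻¹ s≤s)))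

countBelow-all : ∀ {n} (V : Subset n) → countBelow V n ≡ ∣ V ∣
countBelow-all {n} V = trans (sum-cong-≗ {y = λ i → bit (lookup V i)} (λ i →
  trans (cong (bit (lookup V i) *_) (indicator-yes (toℕ i <? n) (FP.toℕ<n i))) (*-identityʳ _)))
  (sym (∣∣≡sum-bit V))

countBelow-mono : ∀ {n} (V : Subset n) {z z′} → z ≤ z′ → countBelow V z ≤ countBelow V z′
countBelow-mono V {z} {z′} z≤z′ = sum-mono-≤ _ _ (λ i → *-monoʳ-≤ (bit (lookup V i))
  (indicator-mono (toℕ i <? z) (toℕ i <? z′) (λ i<z → <-≤-trans i<z z≤z′)))

countBelow-suc : ∀ {n} (V : Subset n) (i : Fin n) →
                 countBelow V (suc (toℕ i)) ≡ countBelow V (toℕ i) + bit (lookup V i)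
countBelow-suc (b ∷ V) zero = begin
  countBelow (b ∷ V) 1           ≡⟨ countBelow-∷ b V 0 ⟩
  bit b + countBelow V 0         ≡⟨ cong (bit b +_) (countBelow-zero V) ⟩
  bit b + 0                      ≡⟨ +-comm (bit b) 0 ⟩
  0 + bit b                      ≡⟨ cong (_+ bit b) (countBelow-zero (b ∷ V)) ⟨
  countBelow (b ∷ V) 0 + bit b   ∎
  where open ≡-Reasoning
countBelow-suc (b ∷ V) (suc i) = begin
  countBelow (b ∷ V) (suc (suc (toℕ i)))                ≡⟨ countBelow-∷ b V (suc (toℕ i)) ⟩
  bit b + countBelow V (suc (toℕ i))                    ≡⟨ cong (bit b +_) (countBelow-suc V i) ⟩
  bit b + (countBelow V (toℕ i) + bit (lookup V i))     ≡⟨ +-assoc (bit b) _ _ ⟨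
  bit b + countBelow V (toℕ i) + bit (lookup V i)       ≡⟨ cong (_+ bit (lookup V i)) (countBelow-∷ b V (toℕ i)) ⟨
  countBelow (b ∷ V) (suc (toℕ i)) + bit (lookup V i)   ∎
  where open ≡-Reasoning

countBelow≤∣∣ : ∀ {n} (V : Subset n) z → countBelow V z ≤ ∣ V ∣
countBelow≤∣∣ V z = subst (countBelow V z ≤_) (sym (∣∣≡sum-bit V)) (sum-mono-≤ _ _ (λ i →
  ≤-trans (*-monoʳ-≤ (bit (lookup V i)) (indicator≤1 (toℕ i <? z))) (≤-reflexive (*-identityʳ _))))

nth : ∀ {n} (V : Subset n) (γ : ℕ) → γ < ∣ V ∣ → Fin n
nth (true ∷ V)  zero    γ<∣V∣ = zero
nth (true ∷ V)  (suc γ) γ<∣V∣ = suc (nth V γ (s<s⁻¹ γ<∣V∣))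
nth (false ∷ V) γ       γ<∣V∣ = suc (nth V γ γ<∣V∣)

nth∈ : ∀ {n} (V : Subset n) γ γ<∣V∣ → lookup V (nth V γ γ<∣V∣) ≡ true
nth∈ (true ∷ V)  zero    γ<∣V∣ = refl
nth∈ (true ∷ V)  (suc γ) γ<∣V∣ = nth∈ V γ (s<s⁻¹ γ<∣V∣)
nth∈ (false ∷ V) γ       γ<∣V∣ = nth∈ V γ γ<∣V∣

countBelow-nth : ∀ {n} (V : Subset n) γ γ<∣V∣ → countBelow V (toℕ (nth V γ γ<∣V∣)) ≡ γ
countBelow-nth (true ∷ V)  zero    γ<∣V∣ = countBelow-zero (true ∷ V)
countBelow-nth (true ∷ V)  (suc γ) γ<∣V∣ =
  trans (countBelow-∷ true V _) (cong suc (countBelow-nth V γ (s<s⁻¹ γ<∣V∣)))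
countBelow-nth (false ∷ V) γ       γ<∣V∣ = trans (countBelow-∷ false V _) (countBelow-nth V γ γ<∣V∣)

nth-mono : ∀ {n} (V : Subset n) γ δ γ<∣V∣ δ<∣V∣ → γ < δ → toℕ (nth V γ γ<∣V∣) < toℕ (nth V δ δ<∣V∣)
nth-mono V γ δ γ<∣V∣ δ<∣V∣ γ<δ with toℕ (nth V γ γ<∣V∣) <? toℕ (nth V δ δ<∣V∣)
... | yes lt = lt
... | no ≮ = ⊥-elim (<⇒≱ γ<δ (subst₂ _≤_ (countBelow-nth V δ δ<∣V∣) (countBelow-nth V γ γ<∣V∣)
                                    (countBelow-mono V (≮⇒≥ ≮))))

-- Values of p at natural-number positions, with junk value 0 outside [0, ℓ).
valℕ : ∀ {ℓ} → Permutation′ ℓ → ℕ → ℕ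
valℕ {ℓ} p i with i <? ℓ
... | yes i<ℓ = val p (fromℕ< i<ℓ)
... | no _    = 0

valℕ-toℕ : ∀ {ℓ} (p : Permutation′ ℓ) (α : Fin ℓ) → valℕ p (toℕ α) ≡ val p α
valℕ-toℕ {ℓ} p α with toℕ α <? ℓ
... | yes α<ℓ = cong (val p) (FP.fromℕ<-toℕ α α<ℓ)
... | no α≮ℓ  = ⊥-elim (α≮ℓ (FP.toℕ<n α))

val-injective : ∀ {ℓ} (p : Permutation′ ℓ) {α β : Fin ℓ} → val p α ≡ val p β → α ≡ β
val-injective p e = trans (sym (inverseˡ p)) (trans (cong (p ⟨$⟩ˡ_) (FP.toℕ-injective e)) (inverseˡ p))

valℕ-fromℕ< : ∀ {ℓ} (p : Permutation′ ℓ) {i} (i<ℓ : i < ℓ) → valℕ p i ≡ val p (fromℕ< i<ℓ)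
valℕ-fromℕ< p i<ℓ = trans (cong (valℕ p) (sym (FP.toℕ-fromℕ< i<ℓ))) (valℕ-toℕ p (fromℕ< i<ℓ))

valℕ-injective : ∀ {ℓ} (p : Permutation′ ℓ) {i j} → i < ℓ → j < ℓ → valℕ p i ≡ valℕ p j → i ≡ j
valℕ-injective p {i} {j} i<ℓ j<ℓ e = begin
  i                  ≡⟨ FP.toℕ-fromℕ< i<ℓ ⟨
  toℕ (fromℕ< i<ℓ)   ≡⟨ cong toℕ (val-injective p (trans (sym (valℕ-fromℕ< p i<ℓ))
                                                            (trans e (valℕ-fromℕ< p j<ℓ)))) ⟩
  toℕ (fromℕ< j<ℓ)   ≡⟨ FP.toℕ-fromℕ< j<ℓ ⟩
  j                  ∎
  where open ≡-Reasoning

record Crossing (f g : ℕ → ℕ) (a N : ℕ) : Set where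
  field
    point : ℕ
    a≤point : a ≤ point
    point<N : point < N
    below : f point ≤ g point
    above : g (suc point) < f (suc point)

crossing : ∀ (f g : ℕ → ℕ) {a} N → a ≤ N → f a ≤ g a → g N < f N → Crossing f g a N
crossing f g zero z≤n fa≤ga gN<fN = ⊥-elim (<⇒≱ gN<fN fa≤ga)
crossing f g {a} (suc N) a≤1+N fa≤ga gN<fN with m≤n⇒m<n∨m≡n a≤1+N
... | inj₂ refl = ⊥-elim (<⇒≱ gN<fN fa≤ga)
... | inj₁ a<1+N with f N ≤? g N
...   | yes fN≤gN = record { point = N ; a≤point = s≤s⁻¹ a<1+N ; point<N = ≤-refl ; below = fN≤gN ; above = gN<fN }
...   | no fN≰gN  = let open Crossing (crossing f g N (s≤s⁻¹ a<1+N) fa≤ga (≰⇒> fN≰gN))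
                    in record { point = point ; a≤point = a≤point ; point<N = m≤n⇒m≤1+n point<N
                              ; below = below ; above = above }

module InSProperties {n : ℕ} {H : Subset n} {π : Vec (Maybe ℕ) n} (ins : InS n H π) where
  value-injective : ∀ {i j v} → lookup π i ≡ just v → lookup π j ≡ just v → i ≡ j
  value-injective {i} {j} {v} πi πj =
    let 1≤v , v≤ = proj₁ (proj₂ ins) i v πi
        _ , _ , unique = proj₂ (proj₂ ins) v 1≤v v≤
    in trans (unique i πi) (sym (unique j πj))

  value-range : ∀ {i v} → lookup π i ≡ just v → 1 ≤ v × v ≤ n ∸ ∣ H ∣
  value-range {i} {v} = proj₁ (proj₂ ins) i v

  value⇒∉ : ∀ {i v} → lookup π i ≡ just v → lookup H i ≡ false
  value⇒∉ {i} πi with lookup H i in i∈H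
  ... | false = refl
  ... | true with trans (sym πi) (from (proj₁ ins i) (VP.lookup⇒[]= i H i∈H))
  ... | ()

  ∉⇒value : ∀ i → lookup H i ≡ false → Σ ℕ λ v → lookup π i ≡ just v
  ∉⇒value i i∉H with lookup π i in πi
  ... | just v  = v , refl
  ... | nothing with trans (sym i∉H) (VP.[]=⇒lookup (to (proj₁ ins i) πi))
  ... | ()

-- Non-holes x < y that can play the indices (holes before x) and (holes before y) + 1 of p in an
-- occurrence made of all holes plus x and y.
record BadPair {n ℓ} (H : Subset n) (p : Permutation′ ℓ) (π : Vec (Maybe ℕ) n) : Set where
  constructor badPair
  field
    x y    : Fin n
    x<y    : toℕ x < toℕ y
    vx vy  : ℕ
    π[x]   : lookup π x ≡ just vx
    π[y]   : lookup π y ≡ just vy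
    agrees : (valℕ p (countBelow H (toℕ x)) < valℕ p (suc (countBelow H (toℕ y)))) ⇔ (vx < vy)

module Occurrence {n k : ℕ} {H : Subset n} {p : Permutation′ (suc (suc k))} {π : Vec (Maybe ℕ) n}
                  (ins : InS n H π) (∣H∣≡k : ∣ H ∣ ≡ k) {σ : Permutation′ n} (ext : Extension σ π)
                  (f : Fin (suc (suc k)) → Fin n) (f-mono : ∀ α β → α F.< β → f α F.< f β)
                  (f-iso : ∀ α β → (val p α < val p β) ⇔ (val σ (f α) < val σ (f β))) where
  open InSProperties {H = H} {π = π} ins

  f-cancel-< : ∀ α β → toℕ (f α) < toℕ (f β) → toℕ α < toℕ β
  f-cancel-< α β fα<fβ with <-cmp (toℕ α) (toℕ β)
  ... | tri< α<β _ _ = α<β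
  ... | tri≈ _ α≡β _ = ⊥-elim (<-irrefl (cong (λ γ → toℕ (f γ)) (FP.toℕ-injective α≡β)) fα<fβ)
  ... | tri> _ _ β<α = ⊥-elim (<-asym fα<fβ (f-mono β α β<α))

  f-injective : ∀ {α β} → toℕ (f α) ≡ toℕ (f β) → α ≡ β
  f-injective {α} {β} fα≡fβ with <-cmp (toℕ α) (toℕ β)
  ... | tri< α<β _ _ = ⊥-elim (<-irrefl fα≡fβ (f-mono α β α<β))
  ... | tri≈ _ α≡β _ = FP.toℕ-injective α≡β
  ... | tri> _ _ β<α = ⊥-elim (<-irrefl (sym fα≡fβ) (f-mono β α β<α))

  before : ℕ → ℕ
  before z = sum (λ α → indicator (toℕ (f α) <? z))

  at : ℕ → ℕ
  at z = sum (λ α → indicator (toℕ (f α) ≟ z))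

  before-suc : ∀ z → before (suc z) ≡ before z + at z
  before-suc z = trans (sum-cong-≗ (λ α → indicator-<-suc (toℕ (f α)) z))
                       (∑-distrib-+ (λ α → indicator (toℕ (f α) <? z)) (λ α → indicator (toℕ (f α) ≟ z)))

  at-cases : ∀ z → (at z ≡ 0) ⊎ (Σ (Fin (suc (suc k))) λ α → toℕ (f α) ≡ z × at z ≡ 1)
  at-cases z with FP.any? (λ α → toℕ (f α) ≟ z)
  ... | yes (α , fα≡z) = inj₂ (α , fα≡z , trans
        (sum-single _ α (λ β β≢α → indicator-no (toℕ (f β) ≟ z)
                                      (λ fβ≡z → β≢α (f-injective (trans fβ≡z (sym fα≡z))))))
        (indicator-yes (toℕ (f α) ≟ z) fα≡z))
  ... | no none = inj₁ (sum-zero _ (λ α → indicator-no (toℕ (f α) ≟ z) (λ fα≡z → none (α , fα≡z))))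

  before-f : ∀ α → before (toℕ (f α)) ≡ toℕ α
  before-f α = trans (sum-cong-≗ (λ β → indicator-cong (toℕ (f β) <? toℕ (f α)) (toℕ β <? toℕ α)
                                                        (f-cancel-< β α) (f-mono β α)))
                     (sum-indicator-< (toℕ α) (<⇒≤ (FP.toℕ<n α)))

  record CrossingPoint (c z : ℕ) : Set where
    field
      α      : Fin (suc (suc k))
      f[α]   : toℕ (f α) ≡ z
      f[α]∉H : lookup H (f α) ≡ false
      α-pos  : toℕ α ≡ countBelow H z + c
      next   : before (suc z) ≡ countBelow H (suc z) + suc c

  -- Where the count of occurrence positions overtakes (holes below z) + c, it does so at a non-hole
  -- position of the occurrence, since it grows by at most one per position.
  crossingPoint : ∀ c z → before z ≤ countBelow H z + c → countBelow H (suc z) + c < before (suc z) → CrossingPoint c z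
  crossingPoint c z below above with at-cases z
  ... | inj₁ at≡0 = ⊥-elim (<⇒≱ above (begin
        before (suc z)          ≡⟨ before-suc z ⟩
        before z + at z         ≡⟨ cong (before z +_) at≡0 ⟩
        before z + 0            ≡⟨ +-identityʳ _ ⟩
        before z                ≤⟨ below ⟩
        countBelow H z + c      ≤⟨ +-monoˡ-≤ c (countBelow-mono H (n≤1+n z)) ⟩
        countBelow H (suc z) + c ∎))
    where open ≤-Reasoning
  ... | inj₂ (α , refl , at≡1) with lookup H (f α) in f[α]∈H | countBelow-suc H (f α)
  ...   | true  | holes-suc = ⊥-elim (<⇒≱ above (begin
          before (suc z)                  ≡⟨ before-suc z ⟩
          before z + at z                 ≡⟨ cong (before z +_) at≡1 ⟩
          before z + 1                    ≤⟨ +-monoˡ-≤ 1 below ⟩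
          countBelow H z + c + 1          ≡⟨ +-assoc (countBelow H z) c 1 ⟩
          countBelow H z + (c + 1)        ≡⟨ cong (countBelow H z +_) (+-comm c 1) ⟩
          countBelow H z + (1 + c)        ≡⟨ +-assoc (countBelow H z) 1 c ⟨
          countBelow H z + 1 + c          ≡⟨ cong (_+ c) holes-suc ⟨
          countBelow H (suc z) + c        ∎))
    where open ≤-Reasoning
  ...   | false | holes-suc = record { α = α ; f[α] = refl ; f[α]∉H = f[α]∈H ; α-pos = α-pos ; next = next }
    where
    holes-same : countBelow H (suc z) ≡ countBelow H z
    holes-same = trans holes-suc (+-identityʳ _)
    before-z : before z ≡ countBelow H z + c
    before-z = ≤-antisym below (s≤s⁻¹ (subst₂ _<_ (cong (_+ c) holes-same)
                 (trans (before-suc z) (trans (cong (before z +_) at≡1) (+-comm (before z) 1))) above))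
    α-pos : toℕ α ≡ countBelow H z + c
    α-pos = trans (sym (before-f α)) before-z
    next : before (suc z) ≡ countBelow H (suc z) + suc c
    next = begin
      before (suc z)                 ≡⟨ before-suc z ⟩
      before z + at z                ≡⟨ cong₂ _+_ before-z at≡1 ⟩
      countBelow H z + c + 1         ≡⟨ +-assoc (countBelow H z) c 1 ⟩
      countBelow H z + (c + 1)       ≡⟨ cong₂ _+_ (sym holes-same) (+-comm c 1) ⟩
      countBelow H (suc z) + suc c   ∎
      where open ≡-Reasoning

  before-all : ∀ c → c < 2 → countBelow H n + c < before n
  before-all c c<2 = subst₂ _<_ (cong (_+ c) (sym (trans (countBelow-all H) ∣H∣≡k))) (sym before-n) (+-monoʳ-< k c<2)
    where
    before-n : before n ≡ k + 2
    before-n = trans (sum-ones _ (λ α → indicator-yes (toℕ (f α) <? n) (FP.toℕ<n (f α)))) (+-comm 2 k)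

  -- The occurrence has k + 2 positions but only k holes are available, so it overtakes the hole
  -- count first by one and then by two; these two crossings are the two non-hole positions.
  occurrence⇒BadPair : BadPair H p π
  occurrence⇒BadPair = badPair (f α) (f β) fα<fβ vx vy πx πy agrees
    where
    first = crossing before (λ z → countBelow H z + 0) n z≤n
              (≤-reflexive (trans before-0 (sym (+-identityʳ _)))) (before-all 0 (s≤s z≤n))
      where
      before-0 : before 0 ≡ countBelow H 0
      before-0 = trans (sum-zero _ (λ α → indicator-no (toℕ (f α) <? 0) (λ ()))) (sym (countBelow-zero H))
    P = crossingPoint 0 (Crossing.point first) (Crossing.below first) (Crossing.above first)
    second = crossing before (λ z → countBelow H z + 1) n (Crossing.point<N first)
               (≤-reflexive (CrossingPoint.next P)) (before-all 1 (s≤s (s≤s z≤n)))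
    Q = crossingPoint 1 (Crossing.point second) (Crossing.below second) (Crossing.above second)
    open CrossingPoint P using (α)
    open CrossingPoint Q using () renaming (α to β)
    fα<fβ : toℕ (f α) < toℕ (f β)
    fα<fβ = subst₂ _<_ (sym (CrossingPoint.f[α] P)) (sym (CrossingPoint.f[α] Q)) (Crossing.a≤point second)
    vx = proj₁ (∉⇒value (f α) (CrossingPoint.f[α]∉H P))
    πx = proj₂ (∉⇒value (f α) (CrossingPoint.f[α]∉H P))
    vy = proj₁ (∉⇒value (f β) (CrossingPoint.f[α]∉H Q))
    πy = proj₂ (∉⇒value (f β) (CrossingPoint.f[α]∉H Q))
    α≡ : valℕ p (countBelow H (toℕ (f α))) ≡ val p α
    α≡ = trans (cong (valℕ p) (sym (trans (CrossingPoint.α-pos P)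
               (trans (+-identityʳ _) (cong (countBelow H) (sym (CrossingPoint.f[α] P)))))))
               (valℕ-toℕ p α)
    β≡ : valℕ p (suc (countBelow H (toℕ (f β)))) ≡ val p β
    β≡ = trans (cong (valℕ p) (sym (trans (CrossingPoint.α-pos Q)
               (trans (+-comm _ 1) (cong (λ z → suc (countBelow H z)) (sym (CrossingPoint.f[α] Q)))))))
               (valℕ-toℕ p β)
    agrees : (valℕ p (countBelow H (toℕ (f α))) < valℕ p (suc (countBelow H (toℕ (f β))))) ⇔ (vx < vy)
    agrees = subst₂ (λ a b → (a < b) ⇔ (vx < vy)) (sym α≡) (sym β≡)
               (⇔-trans (f-iso α β) (⇔-sym (ext (f α) (f β) vx vy πx πy)))

contains⇒BadPair : ∀ {n k} {H : Subset n} {p : Permutation′ (suc (suc k))} {π : Vec (Maybe ℕ) n} →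
                   InS n H π → ∣ H ∣ ≡ k → (σ : Permutation′ n) → Extension σ π → Contains σ p → BadPair H p π
contains⇒BadPair {H = H} {p} {π} ins ∣H∣≡k σ ext (f , f-mono , f-iso) =
  Occurrence.occurrence⇒BadPair {H = H} {p} {π} ins ∣H∣≡k {σ} ext f f-mono f-iso

orderBy : (S : StrictTotalOrder 0ℓ 0ℓ 0ℓ) → ∀ {n} (g : Fin n → StrictTotalOrder.Carrier S) →
          (∀ {i j} → StrictTotalOrder._≈_ S (g i) (g j) → i ≡ j) → StrictLinearOrder n
orderBy S g g-injective = record
  { _≺_         = λ i j → g i <ₛ g j
  ; _≺?_        = λ i j → g i <ₛ? g j
  ; ≺-irrefl    = λ i → irrefl Eq.refl
  ; ≺-trans     = <ₛ-trans
  ; ≺-connected = connected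
  }
  where
  open StrictTotalOrder S using (irrefl; compare; module Eq)
    renaming (_<_ to _<ₛ_; _<?_ to _<ₛ?_; trans to <ₛ-trans)
  connected : ∀ i j → i ≢ j → (g i <ₛ g j) ⊎ (g j <ₛ g i)
  connected i j i≢j with compare (g i) (g j)
  ... | tri< gi<gj _ _ = inj₁ gi<gj
  ... | tri≈ _ gi≈gj _ = ⊥-elim (i≢j (g-injective gi≈gj))
  ... | tri> _ _ gj<gi = inj₂ gj<gi

_<ₗₑₓ_ : ℕ × ℕ → ℕ × ℕ → Set
_<ₗₑₓ_ = ×-Lex _≡_ _<_ _<_

module LexInterpolation (w₁ v₁ w₂ v₂ : ℕ) (w₁<w₂ : w₁ < w₂) (v₁<v₂ : v₁ < v₂) (1≤v₁ : 1 ≤ v₁) where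

  -- Below w₁ the level is v₁ ∸ 1 (which needs 1 ≤ v₁); the offset 0 is reserved for w₁ and w₂.
  level : ℕ → ℕ
  level w with w <? w₁ | w <? w₂
  ... | yes _ | _     = v₁ ∸ 1
  ... | no _  | yes _ = v₁
  ... | no _  | no _  = v₂

  offset : ℕ → ℕ
  offset w with w ≟ w₁ | w ≟ w₂
  ... | yes _ | _     = 0
  ... | no _  | yes _ = 0
  ... | no _  | no _  = suc w

  interpolant : ℕ → ℕ × ℕ
  interpolant w = level w , offset w

  v₁∸1<v₁ : v₁ ∸ 1 < v₁
  v₁∸1<v₁ = ∸-monoʳ-< {m = v₁} {n = 1} {o = 0} (s≤s z≤n) 1≤v₁

  offset≤ : ∀ w → offset w ≤ suc w
  offset≤ w with w ≟ w₁ | w ≟ w₂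
  ... | yes _ | _     = z≤n
  ... | no _  | yes _ = z≤n
  ... | no _  | no _  = ≤-refl

  offset-mono : ∀ w w′ → w < w′ → w′ ≢ w₁ → w′ ≢ w₂ → offset w < offset w′
  offset-mono w w′ w<w′ w′≢w₁ w′≢w₂ with w′ ≟ w₁ | w′ ≟ w₂
  ... | yes w′≡w₁ | _         = ⊥-elim (w′≢w₁ w′≡w₁)
  ... | no _      | yes w′≡w₂ = ⊥-elim (w′≢w₂ w′≡w₂)
  ... | no _      | no _      = ≤-<-trans (offset≤ w) (s≤s w<w′)

  interpolant-w₁ : interpolant w₁ ≡ (v₁ , 0)
  interpolant-w₁ with w₁ <? w₁ | w₁ <? w₂ | w₁ ≟ w₁
  ... | yes w₁<w₁ | _     | _      = ⊥-elim (<-irrefl refl w₁<w₁)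
  ... | no _      | no w₁≮w₂ | _   = ⊥-elim (w₁≮w₂ w₁<w₂)
  ... | no _      | yes _ | yes _  = refl
  ... | no _      | yes _ | no w₁≢w₁ = ⊥-elim (w₁≢w₁ refl)

  interpolant-w₂ : interpolant w₂ ≡ (v₂ , 0)
  interpolant-w₂ with w₂ <? w₁ | w₂ <? w₂ | w₂ ≟ w₁ | w₂ ≟ w₂
  ... | yes w₂<w₁ | _         | _     | _       = ⊥-elim (<-asym w₂<w₁ w₁<w₂)
  ... | no _      | yes w₂<w₂ | _     | _       = ⊥-elim (<-irrefl refl w₂<w₂)
  ... | no _      | no _      | yes _ | _       = refl
  ... | no _      | no _      | no _  | yes _   = refl
  ... | no _      | no _      | no _  | no w₂≢w₂ = ⊥-elim (w₂≢w₂ refl)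

  interpolant-mono : ∀ w w′ → w < w′ → interpolant w <ₗₑₓ interpolant w′
  interpolant-mono w w′ w<w′ with w <? w₁ | w′ <? w₁
  ... | yes _ | yes w′<w₁ = inj₂ (refl , offset-mono w w′ w<w′ (<⇒≢ w′<w₁) (<⇒≢ (<-trans w′<w₁ w₁<w₂)))
  ... | no w≮w₁ | yes w′<w₁ = ⊥-elim (w≮w₁ (<-trans w<w′ w′<w₁))
  ... | yes _ | no _ with w′ <? w₂
  ...   | yes _ = inj₁ v₁∸1<v₁
  ...   | no _  = inj₁ (<-trans v₁∸1<v₁ v₁<v₂)
  interpolant-mono w w′ w<w′ | no w≮w₁ | no _ with w <? w₂ | w′ <? w₂
  ... | yes _ | yes w′<w₂ = inj₂ (refl , offset-mono w w′ w<w′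
                                           (>⇒≢ (≤-<-trans (≮⇒≥ w≮w₁) w<w′)) (<⇒≢ w′<w₂))
  ... | yes _ | no _ = inj₁ v₁<v₂
  ... | no w≮w₂ | yes w′<w₂ = ⊥-elim (w≮w₂ (<-trans w<w′ w′<w₂))
  ... | no w≮w₂ | no _ = inj₂ (refl , offset-mono w w′ w<w′
        (>⇒≢ (<-trans w₁<w₂ (≤-<-trans (≮⇒≥ w≮w₂) w<w′))) (>⇒≢ (≤-<-trans (≮⇒≥ w≮w₂) w<w′)))

rankByKey : ∀ {n} → (Fin n → ℕ × ℕ) → StrictLinearOrder n
rankByKey key = orderBy (×-strictTotalOrder (×-strictTotalOrder <-strictTotalOrder <-strictTotalOrder) <-strictTotalOrder)
                        (λ i → key i , toℕ i) (λ (_ , i≡j) → FP.toℕ-injective i≡j)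

module Completion {n k : ℕ} {H : Subset n} {p : Permutation′ (suc (suc k))} {π : Vec (Maybe ℕ) n}
                  (ins : InS n H π) (∣H∣≡k : ∣ H ∣ ≡ k) (bad : BadPair H p π) where
  open InSProperties {H = H} {π = π} ins
  open BadPair bad

  t u : ℕ
  t = countBelow H (toℕ x)
  u = countBelow H (toℕ y)

  x≢y : x ≢ y
  x≢y x≡y = <-irrefl (cong toℕ x≡y) x<y

  t≤u : t ≤ u
  t≤u = countBelow-mono H (<⇒≤ x<y)

  u≤k : u ≤ k
  u≤k = subst (u ≤_) ∣H∣≡k (countBelow≤∣∣ H (toℕ y))

  wx wy : ℕ
  wx = valℕ p t
  wy = valℕ p (suc u)

  wx≢wy : wx ≢ wy
  wx≢wy wx≡wy =
    <-irrefl (valℕ-injective p (s≤s (m≤n⇒m≤1+n (≤-trans t≤u u≤k))) (s≤s (s≤s u≤k)) wx≡wy) (s≤s t≤u)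

  vx≢vy : vx ≢ vy
  vx≢vy vx≡vy = x≢y (value-injective π[x] (subst (λ v → lookup π y ≡ just v) (sym vx≡vy) π[y]))

  record Interpolant : Set where
    field
      K      : ℕ → ℕ × ℕ
      K-mono : ∀ w w′ → w < w′ → K w <ₗₑₓ K w′
      K-wx   : K wx ≡ (vx , 0)
      K-wy   : K wy ≡ (vy , 0)

  chosenInterpolant : Interpolant
  chosenInterpolant with wx <? wy
  ... | yes wx<wy = record { K = interpolant ; K-mono = interpolant-mono ; K-wx = interpolant-w₁ ; K-wy = interpolant-w₂ }
    where open LexInterpolation wx vx wy vy wx<wy (to agrees wx<wy) (proj₁ (value-range π[x]))
  ... | no wx≮wy  = record { K = interpolant ; K-mono = interpolant-mono ; K-wx = interpolant-w₂ ; K-wy = interpolant-w₁ }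
    where
    wy<wx : wy < wx
    wy<wx = ≤∧≢⇒< (≮⇒≥ wx≮wy) (≢-sym wx≢wy)
    vy<vx : vy < vx
    vy<vx = ≤∧≢⇒< (≮⇒≥ (λ vx<vy → wx≮wy (from agrees vx<vy))) (≢-sym vx≢vy)
    open LexInterpolation wy vy wx vx wy<wx vy<vx (proj₁ (value-range π[y]))

  open Interpolant chosenInterpolant

  inP : Fin n → Bool
  inP i = lookup H i ∨ (does (i FP.≟ x) ∨ does (i FP.≟ y))

  P : Subset n
  P = tabulate inP

  bit-P : ∀ i → bit (lookup P i) ≡ bit (lookup H i) + indicator (i FP.≟ x) + indicator (i FP.≟ y)
  bit-P i rewrite VP.lookup∘tabulate inP i with i FP.≟ x | i FP.≟ y | lookup H i in i∈H
  ... | yes refl | yes x≡y | _     = ⊥-elim (x≢y x≡y)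
  ... | yes refl | no _    | true  = case trans (sym i∈H) (value⇒∉ π[x]) of λ ()
  ... | yes refl | no _    | false = refl
  ... | no _     | yes refl | true  = case trans (sym i∈H) (value⇒∉ π[y]) of λ ()
  ... | no _     | yes refl | false = refl
  ... | no _     | no _     | true  = refl
  ... | no _     | no _     | false = refl

  P-cases : ∀ i → lookup P i ≡ true → (lookup H i ≡ true) ⊎ (i ≡ x) ⊎ (i ≡ y)
  P-cases i i∈P rewrite VP.lookup∘tabulate inP i with i FP.≟ x | i FP.≟ y | lookup H i
  ... | yes i≡x | _       | _     = inj₂ (inj₁ i≡x)
  ... | no _    | yes i≡y | _     = inj₂ (inj₂ i≡y)
  ... | no _    | no _    | true  = inj₁ refl
  ... | no _    | no _    | false = case i∈P of λ ()

  ∣P∣≡ℓ : ∣ P ∣ ≡ suc (suc k)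
  ∣P∣≡ℓ = begin
    ∣ P ∣                                     ≡⟨ ∣∣≡sum-bit P ⟩
    sum (λ i → bit (lookup P i))              ≡⟨ sum-cong-≗ bit-P ⟩
    sum (λ i → bit (lookup H i) + [x] i + [y] i)
      ≡⟨ ∑-distrib-+ (λ i → bit (lookup H i) + [x] i) [y] ⟩
    sum (λ i → bit (lookup H i) + [x] i) + sum [y]
      ≡⟨ cong (_+ sum [y]) (∑-distrib-+ (λ i → bit (lookup H i)) [x]) ⟩
    sum (λ i → bit (lookup H i)) + sum [x] + sum [y]
      ≡⟨ cong₂ (λ a b → a + b + sum [y]) (trans (sym (∣∣≡sum-bit H)) ∣H∣≡k) (single x) ⟩
    k + 1 + sum [y]                           ≡⟨ cong (k + 1 +_) (single y) ⟩
    k + 1 + 1                                 ≡⟨ +-comm (k + 1) 1 ⟩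
    suc (k + 1)                               ≡⟨ cong suc (+-comm k 1) ⟩
    suc (suc k)                               ∎
    where
    open ≡-Reasoning
    [x] [y] : Fin n → ℕ
    [x] i = indicator (i FP.≟ x)
    [y] i = indicator (i FP.≟ y)
    single : ∀ z → sum (λ i → indicator (i FP.≟ z)) ≡ 1
    single z = trans (sum-single _ z (λ i i≢z → indicator-no (i FP.≟ z) i≢z)) (indicator-yes (z FP.≟ z) refl)

  countBelow-P : ∀ z → countBelow P z ≡ countBelow H z + indicator (toℕ x <? z) + indicator (toℕ y <? z)
  countBelow-P z = begin
    countBelow P z                                             ≡⟨ sum-cong-≗ split ⟩
    sum (λ i → bit (lookup H i) * c i + [x] i * c i + [y] i * c i)
      ≡⟨ ∑-distrib-+ (λ i → bit (lookup H i) * c i + [x] i * c i) (λ i → [y] i * c i) ⟩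
    sum (λ i → bit (lookup H i) * c i + [x] i * c i) + sum (λ i → [y] i * c i)
      ≡⟨ cong₂ _+_ (∑-distrib-+ (λ i → bit (lookup H i) * c i) (λ i → [x] i * c i)) (sum-pick y c) ⟩
    countBelow H z + sum (λ i → [x] i * c i) + c y              ≡⟨ cong (λ a → countBelow H z + a + c y) (sum-pick x c) ⟩
    countBelow H z + c x + c y                                 ∎
    where
    open ≡-Reasoning
    c [x] [y] : Fin n → ℕ
    c i = indicator (toℕ i <? z)
    [x] i = indicator (i FP.≟ x)
    [y] i = indicator (i FP.≟ y)
    split : ∀ i → bit (lookup P i) * c i ≡ bit (lookup H i) * c i + [x] i * c i + [y] i * c i
    split i = trans (cong (_* c i) (bit-P i)) (trans (*-distribʳ-+ (c i) (bit (lookup H i) + [x] i) ([y] i))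
                (cong (_+ [y] i * c i) (*-distribʳ-+ (c i) (bit (lookup H i)) ([x] i))))

  countBelow-P-x : countBelow P (toℕ x) ≡ t
  countBelow-P-x = begin
    countBelow P (toℕ x)                                               ≡⟨ countBelow-P (toℕ x) ⟩
    t + indicator (toℕ x <? toℕ x) + indicator (toℕ y <? toℕ x)        ≡⟨ cong₂ (λ a b → t + a + b)
                                                                         (indicator-no (toℕ x <? toℕ x) (<-irrefl refl))
                                                                         (indicator-no (toℕ y <? toℕ x) (<-asym x<y)) ⟩
    t + 0 + 0                                                          ≡⟨ trans (+-identityʳ _) (+-identityʳ t) ⟩
    t                                                                  ∎
    where open ≡-Reasoning

  countBelow-P-y : countBelow P (toℕ y) ≡ suc u
  countBelow-P-y = begin
    countBelow P (toℕ y)                                               ≡⟨ countBelow-P (toℕ y) ⟩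
    u + indicator (toℕ x <? toℕ y) + indicator (toℕ y <? toℕ y)        ≡⟨ cong₂ (λ a b → u + a + b)
                                                                         (indicator-yes (toℕ x <? toℕ y) x<y)
                                                                         (indicator-no (toℕ y <? toℕ y) (<-irrefl refl)) ⟩
    u + 1 + 0                                                          ≡⟨ trans (+-identityʳ _) (+-comm u 1) ⟩
    suc u                                                              ∎
    where open ≡-Reasoning

  α<∣P∣ : ∀ (α : Fin (suc (suc k))) → toℕ α < ∣ P ∣
  α<∣P∣ α = subst (toℕ α <_) (sym ∣P∣≡ℓ) (FP.toℕ<n α)

  f : Fin (suc (suc k)) → Fin n
  f α = nth P (toℕ α) (α<∣P∣ α)

  f-mono : ∀ α β → α F.< β → f α F.< f β
  f-mono α β = nth-mono P (toℕ α) (toℕ β) (α<∣P∣ α) (α<∣P∣ β)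

  -- Non-hole positions keep their value with offset 0; the hole at occurrence index γ gets K (p γ).
  key : Fin n → ℕ × ℕ
  key i with lookup π i
  ... | just v  = v , 0
  ... | nothing = K (valℕ p (countBelow P (toℕ i)))

  key-value : ∀ {i v} → lookup π i ≡ just v → key i ≡ (v , 0)
  key-value {i} πi with lookup π i
  ... | just w  = cong (_, 0) (MP.just-injective πi)
  ... | nothing = case πi of λ ()

  key-P : ∀ i → lookup P i ≡ true → key i ≡ K (valℕ p (countBelow P (toℕ i)))
  key-P i i∈P with lookup π i in πi
  ... | nothing = refl
  ... | just v with P-cases i i∈P
  ...   | inj₁ i∈H = case trans (sym (value⇒∉ πi)) i∈H of λ ()
  ...   | inj₂ (inj₁ refl) = trans (cong (_, 0) (MP.just-injective (trans (sym πi) π[x])))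
                               (trans (sym K-wx) (cong (λ z → K (valℕ p z)) (sym countBelow-P-x)))
  ...   | inj₂ (inj₂ refl) = trans (cong (_, 0) (MP.just-injective (trans (sym πi) π[y])))
                               (trans (sym K-wy) (cong (λ z → K (valℕ p z)) (sym countBelow-P-y)))

  key-f : ∀ α → key (f α) ≡ K (val p α)
  key-f α = trans (key-P (f α) (nth∈ P (toℕ α) (α<∣P∣ α)))
                  (cong K (trans (cong (valℕ p) (countBelow-nth P (toℕ α) (α<∣P∣ α))) (valℕ-toℕ p α)))

  open StrictLinearOrder (rankByKey key) using (≺-irrefl; ≺-trans)
  open Ranking (rankByKey key) using (ranking; ≺⇒ranking<; ranking<⇒≺)

  σ : Permutation′ n
  σ = ranking

  key<⇒σ< : ∀ {i j} → key i <ₗₑₓ key j → val σ i < val σ j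
  key<⇒σ< ki<kj = ≺⇒ranking< (inj₁ ki<kj)

  σ<⇒key≮ : ∀ {i j} → val σ i < val σ j → ¬ (key j <ₗₑₓ key i)
  σ<⇒key≮ σi<σj kj<ki = ≺-irrefl _ (≺-trans (ranking<⇒≺ σi<σj) (inj₁ kj<ki))

  σ-extends : Extension σ π
  σ-extends i j a b πi πj = mk⇔ a<b⇒ σ<⇒a<b
    where
    key< : ∀ {i j a b} → lookup π i ≡ just a → lookup π j ≡ just b → a < b → key i <ₗₑₓ key j
    key< πi πj a<b = subst₂ _<ₗₑₓ_ (sym (key-value πi)) (sym (key-value πj)) (inj₁ a<b)
    a<b⇒ : a < b → val σ i < val σ j
    a<b⇒ a<b = key<⇒σ< (key< πi πj a<b)
    σ<⇒a<b : val σ i < val σ j → a < b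
    σ<⇒a<b σi<σj = ≤∧≢⇒< (≮⇒≥ (λ b<a → σ<⇒key≮ σi<σj (key< πj πi b<a)))
      (λ a≡b → <-irrefl (cong (val σ) (value-injective πi (trans πj (cong just (sym a≡b))))) σi<σj)

  σ-contains : ∀ α β → (val p α < val p β) ⇔ (val σ (f α) < val σ (f β))
  σ-contains α β = mk⇔ p<⇒ σ<⇒p<
    where
    key< : ∀ {α β} → val p α < val p β → key (f α) <ₗₑₓ key (f β)
    key< pα<pβ = subst₂ _<ₗₑₓ_ (sym (key-f _)) (sym (key-f _)) (K-mono _ _ pα<pβ)
    p<⇒ : val p α < val p β → val σ (f α) < val σ (f β)
    p<⇒ pα<pβ = key<⇒σ< (key< pα<pβ)
    σ<⇒p< : val σ (f α) < val σ (f β) → val p α < val p β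
    σ<⇒p< σ< = ≤∧≢⇒< (≮⇒≥ (λ pβ<pα → σ<⇒key≮ σ< (key< pβ<pα)))
      (λ pα≡pβ → <-irrefl (cong (λ γ → val σ (f γ)) (val-injective p pα≡pβ)) σ<)

BadPair⇒¬Avoids : ∀ {n k} {H : Subset n} {p : Permutation′ (suc (suc k))} {π : Vec (Maybe ℕ) n} →
                  InS n H π → ∣ H ∣ ≡ k → BadPair H p π → ¬ Avoids π p
BadPair⇒¬Avoids ins ∣H∣≡k bad avoids = avoids σ σ-extends (f , f-mono , σ-contains)
  where open Completion ins ∣H∣≡k bad

Pattern2413 : ∀ {ℓ} → Permutation′ ℓ → ℕ → ℕ → ℕ → Set
Pattern2413 p t u v = valℕ p (suc u) < valℕ p t × valℕ p t < valℕ p (suc v) × valℕ p (suc v) < valℕ p u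

Pattern3142 : ∀ {ℓ} → Permutation′ ℓ → ℕ → ℕ → ℕ → Set
Pattern3142 p t u v = valℕ p u < valℕ p (suc v) × valℕ p (suc v) < valℕ p t × valℕ p t < valℕ p (suc u)

-- The Baxter condition at positions a = t, b = u, c = u + 1, d = v + 1.
Baxterℕ : ∀ {ℓ} → Permutation′ ℓ → Set
Baxterℕ {ℓ} p = ∀ t u v → t < u → u < v → suc v < ℓ → ¬ Pattern2413 p t u v × ¬ Pattern3142 p t u v

NoBaxterPattern : ℕ → ℕ → ℕ → ℕ → Set
NoBaxterPattern a b c d = ¬ (c < a × a < d × d < b) × ¬ (b < d × d < a × a < c)

noBaxterPattern-cong : ∀ {a b c d a′ b′ c′ d′} → a ≡ a′ → b ≡ b′ → c ≡ c′ → d ≡ d′ →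
                       NoBaxterPattern a b c d → NoBaxterPattern a′ b′ c′ d′
noBaxterPattern-cong refl refl refl refl none = none

isBaxter⇒Baxterℕ : ∀ {ℓ} {p : Permutation′ ℓ} → IsBaxter p → Baxterℕ p
isBaxter⇒Baxterℕ {ℓ} {p} bax t u v t<u u<v 1+v<ℓ =
  noBaxterPattern-cong (sym (valℕ-fromℕ< p t<ℓ)) (sym (valℕ-fromℕ< p u<ℓ))
                       (sym (valℕ-fromℕ< p 1+u<ℓ)) (sym (valℕ-fromℕ< p 1+v<ℓ))
    (bax (fromℕ< t<ℓ) (fromℕ< u<ℓ) (fromℕ< 1+u<ℓ) (fromℕ< 1+v<ℓ)
         (subst₂ _<_ (sym (FP.toℕ-fromℕ< t<ℓ)) (sym (FP.toℕ-fromℕ< u<ℓ)) t<u)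
         (subst₂ _<_ (sym (FP.toℕ-fromℕ< u<ℓ)) (sym (FP.toℕ-fromℕ< 1+u<ℓ)) (n<1+n u))
         (subst₂ _<_ (sym (FP.toℕ-fromℕ< 1+u<ℓ)) (sym (FP.toℕ-fromℕ< 1+v<ℓ)) (s≤s u<v))
         (trans (FP.toℕ-fromℕ< 1+u<ℓ) (cong suc (sym (FP.toℕ-fromℕ< u<ℓ)))))
  where
  1+u<ℓ = <-trans (s≤s u<v) 1+v<ℓ
  u<ℓ   = <-trans (n<1+n u) 1+u<ℓ
  t<ℓ   = <-trans t<u u<ℓ

Baxterℕ⇒isBaxter : ∀ {ℓ} {p : Permutation′ ℓ} → Baxterℕ p → IsBaxter p
Baxterℕ⇒isBaxter {ℓ} {p} bax a b c d a<b b<c c<d c≡1+b with toℕ d in d≡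
... | zero  = case c<d of λ ()
... | suc v =
  noBaxterPattern-cong (valℕ-toℕ p a) (valℕ-toℕ p b)
                       (trans (cong (valℕ p) (sym c≡1+b)) (valℕ-toℕ p c))
                       (trans (cong (valℕ p) (sym d≡)) (valℕ-toℕ p d))
    (bax (toℕ a) (toℕ b) v a<b (s<s⁻¹ (subst (_< suc v) c≡1+b c<d)) (subst (_< ℓ) d≡ (FP.toℕ<n d)))

isBelow : Maybe ℕ → ℕ → ℕ
isBelow nothing  v = 0
isBelow (just w) v = indicator (w <? v)

isEqual : Maybe ℕ → ℕ → ℕ
isEqual nothing  v = 0
isEqual (just w) v = indicator (w ≟ v)

isBelow-suc : ∀ m v → isBelow m (suc v) ≡ isBelow m v + isEqual m v
isBelow-suc nothing  v = refl
isBelow-suc (just w) v = indicator-<-suc w v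

entriesBelow : ∀ {n} → Vec (Maybe ℕ) n → ℕ → ℕ
entriesBelow π v = sum (λ j → isBelow (lookup π j) v)

module Standardisation {n : ℕ} {H : Subset n} {π : Vec (Maybe ℕ) n} (ins : InS n H π) where
  open InSProperties {H = H} {π = π} ins

  entriesAt : ℕ → ℕ
  entriesAt v = sum (λ j → isEqual (lookup π j) v)

  entriesBelow-suc : ∀ v → entriesBelow π (suc v) ≡ entriesBelow π v + entriesAt v
  entriesBelow-suc v = trans (sum-cong-≗ (λ j → isBelow-suc (lookup π j) v))
                             (∑-distrib-+ (λ j → isBelow (lookup π j) v) (λ j → isEqual (lookup π j) v))

  entriesAt-0 : entriesAt 0 ≡ 0
  entriesAt-0 = sum-zero _ at-0
    where
    at-0 : ∀ j → isEqual (lookup π j) 0 ≡ 0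
    at-0 j with lookup π j in πj
    ... | nothing = refl
    ... | just w  = indicator-no (w ≟ 0) (λ w≡0 → <-irrefl (sym w≡0) (proj₁ (value-range πj)))

  entriesBelow-0 : entriesBelow π 0 ≡ 0
  entriesBelow-0 = sum-zero _ below-0
    where
    below-0 : ∀ j → isBelow (lookup π j) 0 ≡ 0
    below-0 j with lookup π j
    ... | nothing = refl
    ... | just w  = indicator-no (w <? 0) (λ ())

  entriesAt-1 : ∀ v → 1 ≤ v → v ≤ n ∸ ∣ H ∣ → entriesAt v ≡ 1
  entriesAt-1 v 1≤v v≤ with proj₂ (proj₂ ins) v 1≤v v≤
  ... | i , πi , unique = trans (sum-single _ i others) (trans (cong (λ m → isEqual m v) πi) (indicator-yes (v ≟ v) refl))
    where
    others : ∀ j → j ≢ i → isEqual (lookup π j) v ≡ 0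
    others j j≢i with lookup π j in πj
    ... | nothing = refl
    ... | just w  = indicator-no (w ≟ v) (λ { refl → j≢i (unique j πj) })

  entriesBelow-suc-v : ∀ v → v ≤ n ∸ ∣ H ∣ → entriesBelow π (suc v) ≡ v
  entriesBelow-suc-v zero    _  = trans (entriesBelow-suc 0) (cong₂ _+_ entriesBelow-0 entriesAt-0)
  entriesBelow-suc-v (suc v) v≤ = begin
    entriesBelow π (suc (suc v))               ≡⟨ entriesBelow-suc (suc v) ⟩
    entriesBelow π (suc v) + entriesAt (suc v) ≡⟨ cong₂ _+_ (entriesBelow-suc-v v (≤-trans (n≤1+n v) v≤))
                                                             (entriesAt-1 (suc v) (s≤s z≤n) v≤) ⟩
    v + 1                                      ≡⟨ +-comm v 1 ⟩
    suc v                                      ∎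
    where open ≡-Reasoning

  value≡1+entriesBelow : ∀ {i v} → lookup π i ≡ just v → v ≡ suc (entriesBelow π v)
  value≡1+entriesBelow {v = zero}  πi = ⊥-elim (<-irrefl refl (proj₁ (value-range πi)))
  value≡1+entriesBelow {v = suc v} πi =
    cong suc (sym (entriesBelow-suc-v v (≤-trans (n≤1+n v) (proj₂ (value-range πi)))))

sameOrder⇒≡ : ∀ {n} {H : Subset n} {π π′ : Vec (Maybe ℕ) n} → InS n H π → InS n H π′ →
              (∀ {i j a b a′ b′} → lookup π i ≡ just a → lookup π j ≡ just b →
                 lookup π′ i ≡ just a′ → lookup π′ j ≡ just b′ → (a < b) ⇔ (a′ < b′)) →
              π ≡ π′
sameOrder⇒≡ {n} {H} {π} {π′} ins ins′ same =
  trans (sym (VP.tabulate∘lookup π)) (trans (VP.tabulate-cong pointwise) (VP.tabulate∘lookup π′))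
  where
  open InSProperties {H = H} {π = π} ins using (∉⇒value)
  open InSProperties {H = H} {π = π′} ins′ using () renaming (∉⇒value to ∉⇒value′)
  hole : ∀ {ρ} → InS n H ρ → ∀ {j} → lookup H j ≡ true → lookup ρ j ≡ nothing
  hole ins {j} j∈H = from (proj₁ ins j) (VP.lookup⇒[]= j H j∈H)
  pointwise : ∀ i → lookup π i ≡ lookup π′ i
  pointwise i with lookup H i in i∈H
  ... | true  = trans (hole {π} ins i∈H) (sym (hole {π′} ins′ i∈H))
  ... | false with ∉⇒value i i∈H | ∉⇒value′ i i∈H
  ...   | a , πi | a′ , π′i = trans πi (trans (cong just a≡a′) (sym π′i))
    where
    below : ∀ j → isBelow (lookup π j) a ≡ isBelow (lookup π′ j) a′
    below j with lookup H j in j∈H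
    ... | true  = trans (cong (λ m → isBelow m a) (hole {π} ins j∈H))
                        (cong (λ m → isBelow m a′) (sym (hole {π′} ins′ j∈H)))
    ... | false with ∉⇒value j j∈H | ∉⇒value′ j j∈H
    ...   | b , πj | b′ , π′j rewrite πj | π′j =
            indicator-cong (b <? a) (b′ <? a′) (to (same πj πi π′j π′i)) (from (same πj πi π′j π′i))
    a≡a′ : a ≡ a′
    a≡a′ = begin
      a                              ≡⟨ Standardisation.value≡1+entriesBelow {π = π} ins πi ⟩
      suc (entriesBelow π a)         ≡⟨ cong suc (sum-cong-≗ below) ⟩
      suc (entriesBelow π′ a′)       ≡⟨ Standardisation.value≡1+entriesBelow {π = π′} ins′ π′i ⟨
      a′                             ∎
      where open ≡-Reasoning

module ForcedOrder {n k : ℕ} (H : Subset n) (p : Permutation′ (suc (suc k))) (∣H∣≡k : ∣ H ∣ ≡ k) where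

  holes : Fin n → ℕ
  holes i = countBelow H (toℕ i)

  holes≤k : ∀ i → holes i ≤ k
  holes≤k i = subst (holes i ≤_) ∣H∣≡k (countBelow≤∣∣ H (toℕ i))

  holes-mono : ∀ {i j} → toℕ i < toℕ j → holes i ≤ holes j
  holes-mono i<j = countBelow-mono H (<⇒≤ i<j)

  Descent : Fin n → Fin n → Set
  Descent i j = valℕ p (suc (holes j)) < valℕ p (holes i)

  -- For non-holes i < j, the pair (i, j) is bad exactly when the order of their values agrees
  -- with the order of p at indices (holes i) and (holes j) + 1; so avoiding p forces π i < π j
  -- to be equivalent to Descent i j.
  _◁_ : Fin n → Fin n → Set
  i ◁ j = (toℕ i < toℕ j × Descent i j) ⊎ (toℕ j < toℕ i × ¬ Descent j i)

  _◁?_ : ∀ i j → Dec (i ◁ j)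
  i ◁? j = ((toℕ i <? toℕ j) ×-dec (valℕ p (suc (holes j)) <? valℕ p (holes i)))
       ⊎-dec ((toℕ j <? toℕ i) ×-dec ¬? (valℕ p (suc (holes i)) <? valℕ p (holes j)))

  ◁-irrefl : ∀ i → ¬ (i ◁ i)
  ◁-irrefl i (inj₁ (i<i , _)) = <-irrefl refl i<i
  ◁-irrefl i (inj₂ (i<i , _)) = <-irrefl refl i<i

  ◁-asym : ∀ {i j} → i ◁ j → ¬ (j ◁ i)
  ◁-asym (inj₁ (i<j , _)) (inj₁ (j<i , _)) = <-asym i<j j<i
  ◁-asym (inj₁ (_ , d))   (inj₂ (_ , ¬d)) = ¬d d
  ◁-asym (inj₂ (_ , ¬d))  (inj₁ (_ , d))  = ¬d d
  ◁-asym (inj₂ (j<i , _)) (inj₂ (i<j , _)) = <-asym i<j j<i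

  ◁-connected : ∀ i j → i ≢ j → (i ◁ j) ⊎ (j ◁ i)
  ◁-connected i j i≢j with <-cmp (toℕ i) (toℕ j)
  ... | tri≈ _ i≡j _ = ⊥-elim (i≢j (FP.toℕ-injective i≡j))
  ... | tri< i<j _ _ with valℕ p (suc (holes j)) <? valℕ p (holes i)
  ...   | yes d = inj₁ (inj₁ (i<j , d))
  ...   | no ¬d = inj₂ (inj₂ (i<j , ¬d))
  ◁-connected i j i≢j | tri> _ _ j<i with valℕ p (suc (holes i)) <? valℕ p (holes j)
  ...   | yes d = inj₂ (inj₁ (j<i , d))
  ...   | no ¬d = inj₁ (inj₂ (j<i , ¬d))

  ◁⇒Descent : ∀ {i j} → toℕ i < toℕ j → i ◁ j → Descent i j
  ◁⇒Descent i<j (inj₁ (_ , d))   = d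
  ◁⇒Descent i<j (inj₂ (j<i , _)) = ⊥-elim (<-asym i<j j<i)

  valℕ-holes≢ : ∀ {i j} → toℕ i < toℕ j → valℕ p (holes i) ≢ valℕ p (suc (holes j))
  valℕ-holes≢ {i} {j} i<j e =
    <-irrefl (valℕ-injective p (s≤s (m≤n⇒m≤1+n (holes≤k i))) (s≤s (s≤s (holes≤k j))) e) (s≤s (holes-mono i<j))

  Realizes : Vec (Maybe ℕ) n → Set
  Realizes π = ∀ {i j a b} → lookup π i ≡ just a → lookup π j ≡ just b → (a < b) ⇔ (i ◁ j)

  realizes-acyclic : ∀ {π x y z a b c} → Realizes π →
                     lookup π x ≡ just a → lookup π y ≡ just b → lookup π z ≡ just c →
                     x ◁ y → y ◁ z → z ◁ x → ⊥
  realizes-acyclic r πx πy πz x◁y y◁z z◁x =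
    <-irrefl refl (<-trans (from (r πx πy) x◁y) (<-trans (from (r πy πz) y◁z) (from (r πz πx) z◁x)))

  realizes⇒¬BadPair : ∀ {π} → Realizes π → ¬ BadPair H p π
  realizes⇒¬BadPair r (badPair x y x<y vx vy πx πy agrees) with <-cmp (valℕ p (holes x)) (valℕ p (suc (holes y)))
  ... | tri< lt _ _  = <-asym lt (◁⇒Descent x<y (to (r πx πy) (to agrees lt)))
  ... | tri≈ _ eq _  = valℕ-holes≢ x<y eq
  ... | tri> _ _ gt  = <-asym gt (from agrees (from (r πx πy) (inj₁ (x<y , gt))))

  realizes⇒avoids : ∀ {π} → InS n H π → Realizes π → Avoids π p
  realizes⇒avoids {π} ins r σ ext occurrence = realizes⇒¬BadPair r (contains⇒BadPair {π = π} ins ∣H∣≡k σ ext occurrence)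

  module _ {π : Vec (Maybe ℕ) n} (ins : InS n H π) (avoids : Avoids π p) where
    open InSProperties {H = H} {π = π} ins

    agree⇔Descent : ∀ {x y a b} → toℕ x < toℕ y → lookup π x ≡ just a → lookup π y ≡ just b →
                    (a < b) ⇔ Descent x y
    agree⇔Descent {x} {y} {a} {b} x<y πx πy = mk⇔ a<b⇒ Descent⇒
      where
      notBad : ¬ ((valℕ p (holes x) < valℕ p (suc (holes y))) ⇔ (a < b))
      notBad agrees = BadPair⇒¬Avoids {π = π} ins ∣H∣≡k (badPair x y x<y a b πx πy agrees) avoids
      a<b⇒ : a < b → Descent x y
      a<b⇒ a<b = ≤∧≢⇒< (≮⇒≥ (λ asc → notBad (mk⇔ (λ _ → a<b) (λ _ → asc)))) (≢-sym (valℕ-holes≢ x<y))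
      Descent⇒ : Descent x y → a < b
      Descent⇒ d with a <? b
      ... | yes a<b = a<b
      ... | no a≮b  = ⊥-elim (notBad (mk⇔ (λ asc → ⊥-elim (<-asym d asc)) (λ a<b → ⊥-elim (a≮b a<b))))

    avoids⇒realizes : Realizes π
    avoids⇒realizes {i} {j} {a} {b} πi πj with <-cmp (toℕ i) (toℕ j)
    ... | tri< i<j _ _ = mk⇔ (λ a<b → inj₁ (i<j , to (agree⇔Descent i<j πi πj) a<b))
                             (λ i◁j → from (agree⇔Descent i<j πi πj) (◁⇒Descent i<j i◁j))
    ... | tri≈ _ i≡j _ = mk⇔ (λ a<b → ⊥-elim (<-irrefl (MP.just-injective (trans (sym πi)
                                 (trans (cong (lookup π) (FP.toℕ-injective i≡j)) πj))) a<b))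
                             (λ i◁j → ⊥-elim (◁-irrefl i (subst (i ◁_) (sym (FP.toℕ-injective i≡j)) i◁j)))
    ... | tri> _ _ j<i = mk⇔ (λ a<b → inj₂ (j<i , λ d → <-asym a<b (from (agree⇔Descent j<i πj πi) d)))
                             ◁⇒a<b
      where
      a≢b : a ≢ b
      a≢b a≡b = <-irrefl (cong toℕ (value-injective πj (subst (λ v → lookup π i ≡ just v) a≡b πi))) j<i
      ◁⇒a<b : i ◁ j → a < b
      ◁⇒a<b (inj₁ (i<j , _)) = ⊥-elim (<-asym i<j j<i)
      ◁⇒a<b (inj₂ (_ , ¬d))  = ≤∧≢⇒< (≮⇒≥ (λ b<a → ¬d (to (agree⇔Descent j<i πj πi) b<a))) a≢b

singleton⇒sCount1 : ∀ {n ℓ} {H : Subset n} {p : Permutation′ ℓ} (c : Vec (Maybe ℕ) n) →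
                    InS n H c → Avoids c p → (∀ π → InS n H π → Avoids π p → π ≡ c) → sCount n H p 1
singleton⇒sCount1 {n} {H = H} {p} c insC avoidsC unique =
  c ∷ [] , All.[] AllPairs.∷ AllPairs.[] , (λ π → mk⇔ (member⇒ π) (⇒member π)) , refl
  where
  member⇒ : ∀ π → π ∈ₗ (c ∷ []) → InS n H π × Avoids π p
  member⇒ π (here refl) = insC , avoidsC
  ⇒member : ∀ π → InS n H π × Avoids π p → π ∈ₗ (c ∷ [])
  ⇒member π (ins , avoids) = here (unique π ins avoids)

sCount1⇒avoider : ∀ {n ℓ} {H : Subset n} {p : Permutation′ ℓ} → sCount n H p 1 →
                  Σ (Vec (Maybe ℕ) n) λ π → InS n H π × Avoids π p
sCount1⇒avoider (π ∷ [] , _ , member , _) = π , to (member π) (here refl)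

module Candidate {n k : ℕ} (H : Subset n) (p : Permutation′ (suc (suc k))) (∣H∣≡k : ∣ H ∣ ≡ k)
                 (baxter : Baxterℕ p) where
  open ForcedOrder H p ∣H∣≡k

  private
    1+holes<ℓ : ∀ i → suc (holes i) < suc (suc k)
    1+holes<ℓ i = s≤s (s≤s (holes≤k i))

  -- A violation of either transitivity law below is a Baxter pattern at (holes a, holes b, holes c).
  descent-trans : ∀ {a b c} → toℕ a < toℕ b → toℕ b < toℕ c → Descent a b → Descent b c → Descent a c
  descent-trans {a} {b} {c} a<b b<c dab dbc
    with m≤n⇒m<n∨m≡n (holes-mono a<b) | m≤n⇒m<n∨m≡n (holes-mono b<c)
  ... | inj₂ t≡u | _        = subst (λ w → valℕ p (suc (holes c)) < valℕ p w) (sym t≡u) dbc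
  ... | inj₁ _   | inj₂ u≡v = subst (λ w → valℕ p (suc w) < valℕ p (holes a)) u≡v dab
  ... | inj₁ t<u | inj₁ u<v with valℕ p (suc (holes c)) <? valℕ p (holes a)
  ...   | yes dac = dac
  ...   | no ¬dac = ⊥-elim (proj₁ (baxter (holes a) (holes b) (holes c) t<u u<v (1+holes<ℓ c))
                      (dab , ≤∧≢⇒< (≮⇒≥ ¬dac) (valℕ-holes≢ (<-trans a<b b<c)) , dbc))

  ascent-trans : ∀ {a b c} → toℕ a < toℕ b → toℕ b < toℕ c → ¬ Descent a b → ¬ Descent b c → ¬ Descent a c
  ascent-trans {a} {b} {c} a<b b<c ¬dab ¬dbc dac
    with m≤n⇒m<n∨m≡n (holes-mono a<b) | m≤n⇒m<n∨m≡n (holes-mono b<c)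
  ... | inj₂ t≡u | _        = ¬dbc (subst (λ w → valℕ p (suc (holes c)) < valℕ p w) t≡u dac)
  ... | inj₁ _   | inj₂ u≡v = ¬dab (subst (λ w → valℕ p (suc w) < valℕ p (holes a)) (sym u≡v) dac)
  ... | inj₁ t<u | inj₁ u<v = proj₂ (baxter (holes a) (holes b) (holes c) t<u u<v (1+holes<ℓ c))
                                (≤∧≢⇒< (≮⇒≥ ¬dbc) (valℕ-holes≢ b<c) , dac ,
                                 ≤∧≢⇒< (≮⇒≥ ¬dab) (valℕ-holes≢ a<b))

  ◁-acyclic : ∀ {x y z} → x ◁ y → y ◁ z → ¬ (z ◁ x)
  ◁-acyclic (inj₁ (x<y , d₁)) (inj₁ (y<z , d₂)) (inj₁ (z<x , _))  = <-asym (<-trans x<y y<z) z<x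
  ◁-acyclic (inj₁ (x<y , d₁)) (inj₁ (y<z , d₂)) (inj₂ (x<z , ¬d)) = ¬d (descent-trans x<y y<z d₁ d₂)
  ◁-acyclic (inj₁ (x<y , d₁)) (inj₂ (z<y , ¬d)) (inj₁ (z<x , d₃)) = ¬d (descent-trans z<x x<y d₃ d₁)
  ◁-acyclic (inj₁ (x<y , d₁)) (inj₂ (z<y , ¬d)) (inj₂ (x<z , ¬e)) = ascent-trans x<z z<y ¬e ¬d d₁
  ◁-acyclic (inj₂ (y<x , ¬d)) (inj₁ (y<z , d₂)) (inj₁ (z<x , d₃)) = ¬d (descent-trans y<z z<x d₂ d₃)
  ◁-acyclic (inj₂ (y<x , ¬d)) (inj₁ (y<z , d₂)) (inj₂ (x<z , ¬e)) = ascent-trans y<x x<z ¬d ¬e d₂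
  ◁-acyclic (inj₂ (y<x , ¬d)) (inj₂ (z<y , ¬e)) (inj₁ (z<x , d₃)) = ascent-trans z<y y<x ¬e ¬d d₃
  ◁-acyclic (inj₂ (y<x , _))  (inj₂ (z<y , _))  (inj₂ (x<z , _))  = <-asym (<-trans z<y y<x) x<z

  ◁-trans : ∀ {x y z} → x ◁ y → y ◁ z → x ◁ z
  ◁-trans {x} {y} {z} x◁y y◁z with x FP.≟ z
  ... | yes refl = ⊥-elim (◁-asym x◁y y◁z)
  ... | no x≢z with ◁-connected x z x≢z
  ...   | inj₁ x◁z = x◁z
  ...   | inj₂ z◁x = ⊥-elim (◁-acyclic x◁y y◁z z◁x)

  Before : Bool → Bool → Fin n → Fin n → Set
  Before true  true  i j = toℕ i < toℕ j
  Before true  false i j = ⊤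
  Before false true  i j = ⊥
  Before false false i j = i ◁ j

  Before? : ∀ a b i j → Dec (Before a b i j)
  Before? true  true  i j = toℕ i <? toℕ j
  Before? true  false i j = yes tt
  Before? false true  i j = no (λ ())
  Before? false false i j = i ◁? j

  candidateOrder : StrictLinearOrder n
  candidateOrder = record
    { _≺_ = λ i j → Before (lookup H i) (lookup H j) i j
    ; _≺?_ = λ i j → Before? (lookup H i) (lookup H j) i j
    ; ≺-irrefl = irrefl ; ≺-trans = trans′ ; ≺-connected = connected }
    where
    irrefl : ∀ i → ¬ Before (lookup H i) (lookup H i) i i
    irrefl i with lookup H i
    ... | true  = <-irrefl refl
    ... | false = ◁-irrefl i
    trans′ : ∀ {i j l} → Before (lookup H i) (lookup H j) i j → Before (lookup H j) (lookup H l) j l →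
             Before (lookup H i) (lookup H l) i l
    trans′ {i} {j} {l} with lookup H i | lookup H j | lookup H l
    ... | true  | true  | true  = <-trans
    ... | true  | true  | false = λ _ _ → tt
    ... | true  | false | true  = λ _ ()
    ... | true  | false | false = λ _ _ → tt
    ... | false | true  | _     = λ ()
    ... | false | false | true  = λ _ ()
    ... | false | false | false = ◁-trans
    connected : ∀ i j → i ≢ j → Before (lookup H i) (lookup H j) i j ⊎ Before (lookup H j) (lookup H i) j i
    connected i j i≢j with lookup H i | lookup H j
    ... | true  | true with <-cmp (toℕ i) (toℕ j)
    ...   | tri< i<j _ _ = inj₁ i<j
    ...   | tri≈ _ i≡j _ = ⊥-elim (i≢j (FP.toℕ-injective i≡j))
    ...   | tri> _ _ j<i = inj₂ j<i
    connected i j i≢j | true  | false = inj₁ tt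
    connected i j i≢j | false | true  = inj₂ tt
    connected i j i≢j | false | false = ◁-connected i j i≢j

  open StrictLinearOrder candidateOrder using (_≺_; _≺?_; ≺-irrefl)
  open Ranking candidateOrder

  rank-hole : ∀ i → lookup H i ≡ true → rank i < k
  rank-hole i i∈H = subst (rank i <_) (trans (sym (∣∣≡sum-bit H)) ∣H∣≡k)
    (sum-mono-< _ (λ j → bit (lookup H j)) below i
      (subst₂ _<_ (sym (indicator-no (i ≺? i) (≺-irrefl i))) (sym (cong bit i∈H)) (s≤s z≤n)))
    where
    below : ∀ j → indicator (j ≺? i) ≤ bit (lookup H j)
    below j with lookup H j | j ≺? i
    ... | true  | d     = indicator≤1 d
    ... | false | no _  = z≤n
    ... | false | yes j≺i = ⊥-elim (subst (λ b → Before false b j i → ⊥) (sym i∈H) (λ ()) j≺i)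

  rank-nonhole : ∀ i → lookup H i ≡ false → k ≤ rank i
  rank-nonhole i i∉H = subst (_≤ rank i) (trans (sym (∣∣≡sum-bit H)) ∣H∣≡k) (sum-mono-≤ _ _ above)
    where
    above : ∀ j → bit (lookup H j) ≤ indicator (j ≺? i)
    above j with lookup H j in j∈H
    ... | false = z≤n
    ... | true  = ≤-reflexive (sym (indicator-yes (Before? true (lookup H i) j i)
                    (subst (λ b → Before true b j i) (sym i∉H) tt)))

  entry : Bool → ℕ → Maybe ℕ
  entry true  r = nothing
  entry false r = just (suc r ∸ k)

  candidate : Vec (Maybe ℕ) n
  candidate = tabulate (λ i → entry (lookup H i) (rank i))

  candidate-value : ∀ {i v} → lookup candidate i ≡ just v → lookup H i ≡ false × v ≡ suc (rank i) ∸ k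
  candidate-value {i} c[i] rewrite VP.lookup∘tabulate (λ i → entry (lookup H i) (rank i)) i with lookup H i
  ... | true  = case c[i] of λ ()
  ... | false = refl , sym (MP.just-injective c[i])

  candidate-∉ : ∀ {i} → lookup H i ≡ false → lookup candidate i ≡ just (suc (rank i) ∸ k)
  candidate-∉ {i} i∉H rewrite VP.lookup∘tabulate (λ i → entry (lookup H i) (rank i)) i | i∉H = refl

  candidate-∈ : ∀ {i} → lookup H i ≡ true → lookup candidate i ≡ nothing
  candidate-∈ {i} i∈H rewrite VP.lookup∘tabulate (λ i → entry (lookup H i) (rank i)) i | i∈H = refl

  1+r∸k+k : ∀ {r} → k ≤ r → suc r ∸ k + k ≡ suc r
  1+r∸k+k k≤r = m∸n+n≡m (m≤n⇒m≤1+n k≤r)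

  1+r∸k-<⇔ : ∀ {r r′} → k ≤ r → k ≤ r′ → (suc r ∸ k < suc r′ ∸ k) ⇔ (r < r′)
  1+r∸k-<⇔ k≤r k≤r′ = mk⇔ (λ lt → s<s⁻¹ (subst₂ _<_ (1+r∸k+k k≤r) (1+r∸k+k k≤r′) (+-monoˡ-< k lt)))
                            (λ lt → ∸-monoˡ-< (s≤s lt) (m≤n⇒m≤1+n k≤r))

  candidate-InS : InS n H candidate
  candidate-InS = holes-exact , value-range , value-attained
    where
    holes-exact : ∀ i → (lookup candidate i ≡ nothing) ⇔ (i ∈ H)
    holes-exact i = mk⇔ nothing⇒∈ (λ i∈H → candidate-∈ (VP.[]=⇒lookup i∈H))
      where
      nothing⇒∈ : lookup candidate i ≡ nothing → i ∈ H
      nothing⇒∈ c[i] with lookup H i in i∈H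
      ... | true  = VP.lookup⇒[]= i H i∈H
      ... | false = case trans (sym c[i]) (candidate-∉ i∈H) of λ ()
    value-range : ∀ i v → lookup candidate i ≡ just v → 1 ≤ v × v ≤ n ∸ ∣ H ∣
    value-range i v c[i] with candidate-value c[i]
    ... | i∉H , refl = subst (1 ≤_) (sym (+-∸-assoc 1 (rank-nonhole i i∉H))) (s≤s z≤n) ,
                       subst (λ h → suc (rank i) ∸ k ≤ n ∸ h) (sym ∣H∣≡k) (∸-monoˡ-≤ k (rank<n i))
    value-attained : ∀ v → 1 ≤ v → v ≤ n ∸ ∣ H ∣ →
                     Σ (Fin n) λ i → lookup candidate i ≡ just v × (∀ j → lookup candidate j ≡ just v → j ≡ i)
    value-attained (suc v) _ v≤ = i , c[i] , unique
      where
      1+v≤n∸k : suc v ≤ n ∸ k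
      1+v≤n∸k = subst (λ h → suc v ≤ n ∸ h) ∣H∣≡k v≤
      k≤n : k ≤ n
      k≤n = <⇒≤ (m∸n≢0⇒n<m (λ n∸k≡0 → case subst (suc v ≤_) n∸k≡0 1+v≤n∸k of λ ()))
      k+v<n : k + v < n
      k+v<n = subst₂ _≤_ (trans (+-comm (suc v) k) (+-suc k v)) (m∸n+n≡m k≤n) (+-monoˡ-≤ k 1+v≤n∸k)
      i = unrank (fromℕ< k+v<n)
      rank-i : rank i ≡ k + v
      rank-i = trans (rank-unrank (fromℕ< k+v<n)) (FP.toℕ-fromℕ< k+v<n)
      i∉H : lookup H i ≡ false
      i∉H with lookup H i in i∈H
      ... | false = refl
      ... | true  = ⊥-elim (<⇒≱ (rank-hole i i∈H) (subst (k ≤_) (sym rank-i) (m≤m+n k v)))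
      c[i] : lookup candidate i ≡ just (suc v)
      c[i] = trans (candidate-∉ i∉H) (cong just (trans (cong (λ r → suc r ∸ k) rank-i)
               (trans (cong (_∸ k) (sym (+-suc k v))) (m+n∸m≡n k (suc v)))))
      unique : ∀ j → lookup candidate j ≡ just (suc v) → j ≡ i
      unique j c[j] with candidate-value c[j]
      ... | j∉H , 1+v≡ = rank-injective (suc-injective (begin
        suc (rank j)            ≡⟨ 1+r∸k+k (rank-nonhole j j∉H) ⟨
        suc (rank j) ∸ k + k    ≡⟨ cong (_+ k) (trans (sym 1+v≡) (MP.just-injective (trans (sym c[i]) (candidate-∉ i∉H)))) ⟩
        suc (rank i) ∸ k + k    ≡⟨ 1+r∸k+k (rank-nonhole i i∉H) ⟩
        suc (rank i)            ∎))
        where open ≡-Reasoning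

  candidate-realizes : Realizes candidate
  candidate-realizes {i} {j} c[i] c[j] with candidate-value c[i] | candidate-value c[j]
  ... | i∉H , refl | j∉H , refl = ⇔-trans (1+r∸k-<⇔ (rank-nonhole i i∉H) (rank-nonhole j j∉H))
        (mk⇔ (λ lt → ≺⇒◁ (rank-cancel-< lt)) (λ i◁j → rank-mono (◁⇒≺ i◁j)))
    where
    ≺⇒◁ : i ≺ j → i ◁ j
    ≺⇒◁ i≺j rewrite i∉H | j∉H = i≺j
    ◁⇒≺ : i ◁ j → i ≺ j
    ◁⇒≺ i◁j rewrite i∉H | j∉H = i◁j

baxter⇒sCount1 : ∀ {n k} (H : Subset n) (p : Permutation′ (suc (suc k))) → ∣ H ∣ ≡ k → Baxterℕ p → sCount n H p 1
baxter⇒sCount1 {n} H p ∣H∣≡k baxter =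
  singleton⇒sCount1 {H = H} {p} candidate candidate-InS (realizes⇒avoids {candidate} candidate-InS candidate-realizes)
    (λ π ins avoids → sameOrder⇒≡ {π = π} ins candidate-InS (λ πi πj ci cj →
       ⇔-trans (avoids⇒realizes {π} ins avoids πi πj) (⇔-sym (candidate-realizes ci cj))))
  where
  open ForcedOrder H p ∣H∣≡k
  open Candidate H p ∣H∣≡k baxter

-- Among the first k + 3 positions, only X = t, Y = u + 1 and Z = v + 2 are non-holes, so exactly
-- t, u and v holes precede them.
module Counterexample {n k : ℕ} (p : Permutation′ (suc (suc k))) (k+3≤n : k + 3 ≤ n)
                      (t u v : ℕ) (t<u : t < u) (u<v : u < v) (v≤k : v ≤ k) where
  K X Y Z : ℕ
  K = k + 3
  X = t
  Y = suc u
  Z = suc (suc v)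

  Z<K : Z < K
  Z<K = subst (Z <_) (+-comm 3 k) (s≤s (s≤s (s≤s v≤k)))
  Y<Z : Y < Z
  Y<Z = s≤s (<-trans u<v (n<1+n v))
  X<Y : X < Y
  X<Y = <-trans t<u (n<1+n u)
  Y<K : Y < K
  Y<K = <-trans Y<Z Z<K
  X<K : X < K
  X<K = <-trans X<Y Y<K

  X<n : X < n
  X<n = <-≤-trans X<K k+3≤n
  Y<n : Y < n
  Y<n = <-≤-trans Y<K k+3≤n
  Z<n : Z < n
  Z<n = <-≤-trans Z<K k+3≤n

  posX posY posZ : Fin n
  posX = fromℕ< X<n
  posY = fromℕ< Y<n
  posZ = fromℕ< Z<n

  inH : Fin n → Bool
  inH i = does (toℕ i <? K) ∧ (not (does (toℕ i ≟ X)) ∧ (not (does (toℕ i ≟ Y)) ∧ not (does (toℕ i ≟ Z))))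

  H : Subset n
  H = tabulate inH

  [X] [Y] [Z] [<K] : Fin n → ℕ
  [X] i = indicator (toℕ i ≟ X)
  [Y] i = indicator (toℕ i ≟ Y)
  [Z] i = indicator (toℕ i ≟ Z)
  [<K] i = indicator (toℕ i <? K)

  split-bits : ∀ {a : ℕ} (d0 : Dec (a < K)) (d1 : Dec (a ≡ X)) (d2 : Dec (a ≡ Y)) (d3 : Dec (a ≡ Z)) →
               bit (does d0 ∧ (not (does d1) ∧ (not (does d2) ∧ not (does d3))))
                 + indicator d1 + indicator d2 + indicator d3 ≡ indicator d0
  split-bits (yes _) (no _) (no _) (no _) = refl
  split-bits (yes _) (yes _) (no _) (no _) = refl
  split-bits (yes _) (no _) (yes _) (no _) = refl
  split-bits (yes _) (no _) (no _) (yes _) = refl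
  split-bits _ (yes e1) (yes e2) _ = ⊥-elim (<⇒≢ X<Y (trans (sym e1) e2))
  split-bits _ (yes e1) _ (yes e2) = ⊥-elim (<⇒≢ (<-trans X<Y Y<Z) (trans (sym e1) e2))
  split-bits _ _ (yes e1) (yes e2) = ⊥-elim (<⇒≢ Y<Z (trans (sym e1) e2))
  split-bits (no K≮) (yes e) (no _) (no _) = ⊥-elim (K≮ (subst (_< K) (sym e) X<K))
  split-bits (no K≮) (no _) (yes e) (no _) = ⊥-elim (K≮ (subst (_< K) (sym e) Y<K))
  split-bits (no K≮) (no _) (no _) (yes e) = ⊥-elim (K≮ (subst (_< K) (sym e) Z<K))
  split-bits (no _) (no _) (no _) (no _) = refl

  bit-H : ∀ i → bit (lookup H i) + [X] i + [Y] i + [Z] i ≡ [<K] i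
  bit-H i = trans (cong (λ b → bit b + [X] i + [Y] i + [Z] i) (VP.lookup∘tabulate inH i))
                   (split-bits (toℕ i <? K) (toℕ i ≟ X) (toℕ i ≟ Y) (toℕ i ≟ Z))

  sum-pickℕ : ∀ (P : ℕ) (P<n : P < n) (c : Fin n → ℕ) → sum (λ i → indicator (toℕ i ≟ P) * c i) ≡ c (fromℕ< P<n)
  sum-pickℕ P P<n c = trans (sum-cong-≗ {y = (λ i → indicator (i FP.≟ fromℕ< P<n) * c i)}
      (λ i → cong (_* c i) (indicator-cong (toℕ i ≟ P) (i FP.≟ fromℕ< P<n)
         (λ e → FP.toℕ-injective (trans e (sym (FP.toℕ-fromℕ< P<n))))
         (λ e → trans (cong toℕ e) (FP.toℕ-fromℕ< P<n)))))
    (sum-pick (fromℕ< P<n) c)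

  countBelow-H : ∀ z → countBelow H z + indicator (X <? z) + indicator (Y <? z) + indicator (Z <? z)
                       ≡ sum (λ i → [<K] i * indicator (toℕ i <? z))
  countBelow-H z = sym (begin
      sum (λ i → [<K] i * c i) ≡⟨ sum-cong-≗ split ⟩
      sum (λ i → bit (lookup H i) * c i + [X] i * c i + [Y] i * c i + [Z] i * c i)
        ≡⟨ ∑-distrib-+ (λ i → bit (lookup H i) * c i + [X] i * c i + [Y] i * c i) (λ i → [Z] i * c i) ⟩
      sum (λ i → bit (lookup H i) * c i + [X] i * c i + [Y] i * c i) + sum (λ i → [Z] i * c i)
        ≡⟨ cong₂ _+_ (∑-distrib-+ (λ i → bit (lookup H i) * c i + [X] i * c i) (λ i → [Y] i * c i)) (sum-pickℕ Z Z<n c) ⟩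
      sum (λ i → bit (lookup H i) * c i + [X] i * c i) + sum (λ i → [Y] i * c i) + c posZ
        ≡⟨ cong₂ (λ a b → a + b + c posZ) (∑-distrib-+ (λ i → bit (lookup H i) * c i) (λ i → [X] i * c i))
                 (sum-pickℕ Y Y<n c) ⟩
      countBelow H z + sum (λ i → [X] i * c i) + c posY + c posZ
        ≡⟨ cong (λ a → countBelow H z + a + c posY + c posZ) (sum-pickℕ X X<n c) ⟩
      countBelow H z + c posX + c posY + c posZ
        ≡⟨ cong₃ (λ a b d → countBelow H z + indicator (a <? z) + indicator (b <? z) + indicator (d <? z))
                 (FP.toℕ-fromℕ< X<n) (FP.toℕ-fromℕ< Y<n) (FP.toℕ-fromℕ< Z<n) ⟩
      countBelow H z + indicator (X <? z) + indicator (Y <? z) + indicator (Z <? z) ∎)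
    where
    open ≡-Reasoning
    cong₃ : ∀ (f : ℕ → ℕ → ℕ → ℕ) {a a' b b' d d'} → a ≡ a' → b ≡ b' → d ≡ d' → f a b d ≡ f a' b' d'
    cong₃ f refl refl refl = refl
    c : Fin n → ℕ
    c i = indicator (toℕ i <? z)
    split : ∀ i → [<K] i * c i ≡ bit (lookup H i) * c i + [X] i * c i + [Y] i * c i + [Z] i * c i
    split i = trans (cong (_* c i) (sym (bit-H i)))
      (trans (*-distribʳ-+ (c i) (bit (lookup H i) + [X] i + [Y] i) ([Z] i))
        (cong (_+ [Z] i * c i) (trans (*-distribʳ-+ (c i) (bit (lookup H i) + [X] i) ([Y] i))
          (cong (_+ [Y] i * c i) (*-distribʳ-+ (c i) (bit (lookup H i)) ([X] i))))))

  sum-[<K] : ∀ z → z ≤ K → sum (λ i → [<K] i * indicator (toℕ i <? z)) ≡ z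
  sum-[<K] z z≤K = trans (sum-cong-≗ below-z) (sum-indicator-< z (≤-trans z≤K k+3≤n))
    where
    below-z : ∀ i → [<K] i * indicator (toℕ i <? z) ≡ indicator (toℕ i <? z)
    below-z i with toℕ i <? z
    ... | no _    = *-zeroʳ ([<K] i)
    ... | yes i<z = trans (*-identityʳ _) (indicator-yes (toℕ i <? K) (<-≤-trans i<z z≤K))

  sum-[<K]-all : sum (λ i → [<K] i * indicator (toℕ i <? n)) ≡ K
  sum-[<K]-all = trans (sum-cong-≗ (λ i → trans (cong ([<K] i *_) (indicator-yes (toℕ i <? n) (FP.toℕ<n i)))
                                                 (*-identityʳ _)))
                       (sum-indicator-< K k+3≤n)

  cong₄ : ∀ {a a' b b' d d' e e'} → a ≡ a' → b ≡ b' → d ≡ d' → e ≡ e' → a + b + d + e ≡ a' + b' + d' + e'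
  cong₄ refl refl refl refl = refl

  ∣H∣≡k : ∣ H ∣ ≡ k
  ∣H∣≡k = +-cancelʳ-≡ 3 ∣ H ∣ k (begin
      ∣ H ∣ + 3 ≡⟨ sym (trans (+-assoc (∣ H ∣ + 1) 1 1) (+-assoc ∣ H ∣ 1 2)) ⟩
      ∣ H ∣ + 1 + 1 + 1 ≡⟨ cong₄ (sym (countBelow-all H)) (sym (indicator-yes (X <? n) X<n))
                                 (sym (indicator-yes (Y <? n) Y<n)) (sym (indicator-yes (Z <? n) Z<n)) ⟩
      countBelow H n + indicator (X <? n) + indicator (Y <? n) + indicator (Z <? n) ≡⟨ countBelow-H n ⟩
      sum (λ i → [<K] i * indicator (toℕ i <? n)) ≡⟨ sum-[<K]-all ⟩
      k + 3 ∎)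
    where
    open ≡-Reasoning

  countBelow-X : countBelow H X ≡ t
  countBelow-X = trans (sym (trans (cong₄ refl (indicator-no (X <? X) (<-irrefl refl)) (indicator-no (Y <? X) (<-asym X<Y))
                                              (indicator-no (Z <? X) (<-asym (<-trans X<Y Y<Z))))
                  (trans (+-identityʳ _) (trans (+-identityʳ _) (+-identityʳ _)))))
          (trans (countBelow-H X) (sum-[<K] X (<⇒≤ X<K)))

  countBelow-Y : countBelow H Y ≡ u
  countBelow-Y = suc-injective (trans (+-comm 1 _) (trans (sym indicators) (trans (countBelow-H Y) (sum-[<K] Y (<⇒≤ Y<K)))))
    where
    indicators : countBelow H Y + indicator (X <? Y) + indicator (Y <? Y) + indicator (Z <? Y) ≡ countBelow H Y + 1
    indicators = trans (cong₄ refl (indicator-yes (X <? Y) X<Y) (indicator-no (Y <? Y) (<-irrefl refl))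
                           (indicator-no (Z <? Y) (<-asym Y<Z)))
               (trans (+-identityʳ _) (+-identityʳ _))

  countBelow-Z : countBelow H Z ≡ v
  countBelow-Z = suc-injective (suc-injective (trans (+-comm 2 _) (trans (sym indicators) (trans (countBelow-H Z) (sum-[<K] Z (<⇒≤ Z<K))))))
    where
    indicators : countBelow H Z + indicator (X <? Z) + indicator (Y <? Z) + indicator (Z <? Z) ≡ countBelow H Z + 2
    indicators = trans (cong₄ refl (indicator-yes (X <? Z) (<-trans X<Y Y<Z)) (indicator-yes (Y <? Z) Y<Z)
                           (indicator-no (Z <? Z) (<-irrefl refl)))
               (trans (+-identityʳ _) (+-assoc _ 1 1))

  nonhole-bits : ∀ {a : ℕ} (d0 : Dec (a < K)) (d1 : Dec (a ≡ X)) (d2 : Dec (a ≡ Y)) (d3 : Dec (a ≡ Z)) →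
    (a ≡ X) ⊎ ((a ≡ Y) ⊎ (a ≡ Z)) → does d0 ∧ (not (does d1) ∧ (not (does d2) ∧ not (does d3))) ≡ false
  nonhole-bits (no _) _ _ _ _ = refl
  nonhole-bits (yes _) (yes _) _ _ _ = refl
  nonhole-bits (yes _) (no _) (yes _) _ _ = refl
  nonhole-bits (yes _) (no _) (no _) (yes _) _ = refl
  nonhole-bits (yes _) (no a) (no _) (no _) (inj₁ e) = ⊥-elim (a e)
  nonhole-bits (yes _) (no _) (no b) (no _) (inj₂ (inj₁ e)) = ⊥-elim (b e)
  nonhole-bits (yes _) (no _) (no _) (no c) (inj₂ (inj₂ e)) = ⊥-elim (c e)

  XYZ∉H : ∀ i → (toℕ i ≡ X) ⊎ ((toℕ i ≡ Y) ⊎ (toℕ i ≡ Z)) → lookup H i ≡ false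
  XYZ∉H i w = trans (VP.lookup∘tabulate inH i) (nonhole-bits (toℕ i <? K) (toℕ i ≟ X) (toℕ i ≟ Y) (toℕ i ≟ Z) w)

  posX∉H : lookup H posX ≡ false
  posX∉H = XYZ∉H posX (inj₁ (FP.toℕ-fromℕ< X<n))
  posY∉H : lookup H posY ≡ false
  posY∉H = XYZ∉H posY (inj₂ (inj₁ (FP.toℕ-fromℕ< Y<n)))
  posZ∉H : lookup H posZ ≡ false
  posZ∉H = XYZ∉H posZ (inj₂ (inj₂ (FP.toℕ-fromℕ< Z<n)))

  holes-X : countBelow H (toℕ posX) ≡ t
  holes-X = trans (cong (countBelow H) (FP.toℕ-fromℕ< X<n)) countBelow-X
  holes-Y : countBelow H (toℕ posY) ≡ u
  holes-Y = trans (cong (countBelow H) (FP.toℕ-fromℕ< Y<n)) countBelow-Y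
  holes-Z : countBelow H (toℕ posZ) ≡ v
  holes-Z = trans (cong (countBelow H) (FP.toℕ-fromℕ< Z<n)) countBelow-Z

  posX<posY : toℕ posX < toℕ posY
  posX<posY = subst₂ _<_ (sym (FP.toℕ-fromℕ< X<n)) (sym (FP.toℕ-fromℕ< Y<n)) X<Y
  posY<posZ : toℕ posY < toℕ posZ
  posY<posZ = subst₂ _<_ (sym (FP.toℕ-fromℕ< Y<n)) (sym (FP.toℕ-fromℕ< Z<n)) Y<Z

  module _ (count : sCount n H p 1) where
    open ForcedOrder H p ∣H∣≡k

    avoider = sCount1⇒avoider {H = H} {p} count
    π = proj₁ avoider
    realizes : Realizes π
    realizes = avoids⇒realizes {π} (proj₁ (proj₂ avoider)) (proj₂ (proj₂ avoider))

    open InSProperties {H = H} {π = π} (proj₁ (proj₂ avoider)) using (∉⇒value)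

    πX = proj₂ (∉⇒value posX posX∉H)
    πY = proj₂ (∉⇒value posY posY∉H)
    πZ = proj₂ (∉⇒value posZ posZ∉H)

    descent : ∀ {i j a b} → holes i ≡ a → holes j ≡ b → Descent i j ≡ (valℕ p (suc b) < valℕ p a)
    descent refl refl = refl

    no2413 : ¬ Pattern2413 p t u v
    no2413 (pu<pt , pt<pv , pv<pu) = realizes-acyclic {π} realizes πX πY πZ
      (inj₁ (posX<posY , subst id (sym (descent holes-X holes-Y)) pu<pt))
      (inj₁ (posY<posZ , subst id (sym (descent holes-Y holes-Z)) pv<pu))
      (inj₂ (<-trans posX<posY posY<posZ , λ d → <-asym pt<pv (subst id (descent holes-X holes-Z) d)))

    no3142 : ¬ Pattern3142 p t u v
    no3142 (pu<pv , pv<pt , pt<pu) = realizes-acyclic {π} realizes πX πZ πY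
      (inj₁ (<-trans posX<posY posY<posZ , subst id (sym (descent holes-X holes-Z)) pv<pt))
      (inj₂ (posY<posZ , λ d → <-asym pu<pv (subst id (descent holes-Y holes-Z) d)))
      (inj₂ (posX<posY , λ d → <-asym pt<pu (subst id (descent holes-X holes-Y) d)))

sCount1⇒Baxter : ∀ {k} (p : Permutation′ (suc (suc k))) → Σ ℕ (λ n → (k + 3 ≤ n) ×
                   ((H : Subset n) → ∣ H ∣ ≡ k → sCount n H p 1)) → IsBaxter p
sCount1⇒Baxter p (n , k+3≤n , all) = Baxterℕ⇒isBaxter λ t u v t<u u<v 1+v<ℓ →
  let open Counterexample p k+3≤n t u v t<u u<v (s≤s⁻¹ (s<s⁻¹ 1+v<ℓ))
  in no2413 (all H ∣H∣≡k) , no3142 (all H ∣H∣≡k)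

proposition25 : (ℓ : ℕ) → 2 ≤ ℓ → (p : Permutation′ ℓ) →
    (IsBaxter p ⇔ (∀ (n : ℕ) → ℓ ∸ 2 ≤ n → (H : Subset n) → ∣ H ∣ ≡ ℓ ∸ 2 → sCount n H p 1))
    × (IsBaxter p ⇔ ((H : Subset ((ℓ ∸ 2) + 3)) → ∣ H ∣ ≡ ℓ ∸ 2 → sCount ((ℓ ∸ 2) + 3) H p 1))
    × (IsBaxter p ⇔ Σ ℕ (λ n → ((ℓ ∸ 2) + 3 ≤ n) × ((H : Subset n) → ∣ H ∣ ≡ ℓ ∸ 2 → sCount n H p 1)))
proposition25 (suc (suc k)) (s≤s (s≤s z≤n)) p =
  mk⇔ (λ bax n _ → all n bax) (λ all′ → sCount1⇒Baxter p (k + 3 , ≤-refl , all′ (k + 3) (m≤m+n k 3))) ,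
  mk⇔ (all (k + 3)) (λ all′ → sCount1⇒Baxter p (k + 3 , ≤-refl , all′)) ,
  mk⇔ (λ bax → k + 3 , ≤-refl , all (k + 3) bax) (sCount1⇒Baxter p)
  where
  all : ∀ n → IsBaxter p → (H : Subset n) → ∣ H ∣ ≡ k → sCount n H p 1
  all n bax H ∣H∣≡k = baxter⇒sCount1 H p ∣H∣≡k (isBaxter⇒Baxterℕ bax)
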